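{- The map $\delta$ is a bijection from the set of permutations of $\{1,\ldots,n\}$ to the set of noncrossing arc diagrams on $n$ points.
   Context: Noncrossing arc diagrams: place points $1,\ldots,n$ bottom to top on a vertical line; an arc joins $p<q$, moving monotonically upward and passing left or right of each point strictly between; arcs are considered up to combinatorial equivalence (determined by endpoints and which intermediate points lie to their left). A noncrossing arc diagram is a collection of arcs such that no two intersect except at endpoints and no two share an upper endpoint or a lower endpoint, considered up to combinatorial equivalence. Weak order: $x\le y$ iff $\operatorname{inv}(x)\subseteq\operatorname{inv}(y)$, where $\operatorname{inv}(x)$ is the set of pairs $(x_i,x_j)$, $i<j$, $x_i>x_j$. A permutation is join-irreducible in the weak order iff it has exactly one descent. A join-irreducible permutation $x$ with unique descent $x_i=b>x_{i+1}=a$ corresponds to the arc joining $a$ and $b$ in which each $c$ with $a<c<b$ lies to the left of the arc iff $c$ occurs in $x$ to the left of the descent; this is a bijection between join-irreducible permutations and arcs. The canonical join representation of $x$ in a finite lattice is the irredundant join representation $x=\bigvee S$ such that for every $T$ with $x=\bigvee T$ each element of $S$ lies below some element of $T$; in the weak order every permutation has one, consisting of join-irreducible permutations. The map $\delta$ sends a permutation $x$ to the set of arcs corresponding to the join-irreducible permutations in its canonical join representation. -}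

module Defs where

open import Data.Nat as ℕ using (ℕ; suc)
open import Data.Fin as Fin using (Fin; toℕ; _≟_)
open import Data.Fin.Subset using (Subset)
open import Data.Bool using (Bool; true; false; if_then_else_)
open import Data.Vec using (Vec; lookup)
open import Data.List using (List; length)
import Data.List as List
open import Data.List.Membership.Propositional using (_∈_)
open import Data.List.Relation.Binary.Subset.Propositional using (_⊆_)
open import Data.Product using (Σ; ∃; ∃-syntax; _×_; _,_)
open import Data.Sum using (_⊎_)
open import Relation.Nullary using (¬_; does)
open import Relation.Binary.PropositionalEquality using (_≡_; _≢_)
open import Function.Bundles using (_⇔_)

-- Points 1,…,n are represented by Fin n (i.e. 0,…,n-1), positions too.
-- A permutation x is a word x = x₀ x₁ … x_{n-1} (a Vec (Fin n) n)
-- using every letter exactly once (equivalently: injective).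

IsPerm : {n : ℕ} → Vec (Fin n) n → Set
IsPerm {n} x = (i j : Fin n) → lookup x i ≡ lookup x j → i ≡ j

Inv : {n : ℕ} → Vec (Fin n) n → Fin n → Fin n → Set
Inv {n} x a b =
  Σ (Fin n) λ i → Σ (Fin n) λ j →
    i Fin.< j × lookup x i ≡ a × lookup x j ≡ b × b Fin.< a

_≤w_ : {n : ℕ} → Vec (Fin n) n → Vec (Fin n) n → Set
_≤w_ {n} x y = (a b : Fin n) → Inv x a b → Inv y a b

IsJoin : {n : ℕ} → List (Vec (Fin n) n) → Vec (Fin n) n → Set
IsJoin {n} T x =
  ((t : Vec (Fin n) n) → t ∈ T → t ≤w x) ×
  ((y : Vec (Fin n) n) → IsPerm y → ((t : Vec (Fin n) n) → t ∈ T → t ≤w y) → x ≤w y)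

IsCanonicalJoinRep : {n : ℕ} → Vec (Fin n) n → List (Vec (Fin n) n) → Set
IsCanonicalJoinRep {n} x S =
  ((s : Vec (Fin n) n) → s ∈ S → IsPerm s) ×
  IsJoin S x ×
  ((S′ : List (Vec (Fin n) n)) → S′ ⊆ S → ¬ (S ⊆ S′) → ¬ IsJoin S′ x) ×
  ((T : List (Vec (Fin n) n)) → ((t : Vec (Fin n) n) → t ∈ T → IsPerm t) →
     IsJoin T x → (s : Vec (Fin n) n) → s ∈ S →
     Σ (Vec (Fin n) n) λ t → t ∈ T × s ≤w t)

-- An arc is given (up to combinatorial equivalence) by its lower
-- endpoint lo, upper endpoint hi (lo < hi) and the set of points lying to
-- its left; only the points strictly between lo and hi are relevant.

record Arc (n : ℕ) : Set where
  constructor arc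
  field
    lo   : Fin n
    hi   : Fin n
    left : Subset n

open Arc public

ValidArc : {n : ℕ} → Arc n → Set
ValidArc α = lo α Fin.< hi α

_≈a_ : {n : ℕ} → Arc n → Arc n → Set
_≈a_ {n} α β =
  lo α ≡ lo β × hi α ≡ hi β ×
  ((c : Fin n) → lo α Fin.< c → c Fin.< hi α →
     (lookup (left α) c ≡ true ⇔ lookup (left β) c ≡ true))

-- Horizontal position of an arc at the height of point c (for lo ≤ c ≤ hi):
-- 0 = passes to the left of c, 1 = at c (an endpoint), 2 = passes to the right of c.
posAt : {n : ℕ} → Arc n → Fin n → ℕ
posAt α c =
  if does (c ≟ lo α) then 1 else
  if does (c ≟ hi α) then 1 else
  if lookup (left α) c then 2 else 0

InBoth : {n : ℕ} → Arc n → Arc n → Fin n → Set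
InBoth α β c =
  lo α Fin.≤ c × c Fin.≤ hi α × lo β Fin.≤ c × c Fin.≤ hi β

-- Two arcs cross (intersect other than at endpoints) iff at some common height
-- α is forced strictly to the right of β and at another common height
-- strictly to the left of β.
Cross : {n : ℕ} → Arc n → Arc n → Set
Cross {n} α β =
  (Σ (Fin n) λ c → InBoth α β c × posAt β c ℕ.< posAt α c) ×
  (Σ (Fin n) λ c → InBoth α β c × posAt α c ℕ.< posAt β c)

Diagram : ℕ → Set
Diagram n = List (Arc n)

IsNoncrossingDiagram : {n : ℕ} → Diagram n → Set
IsNoncrossingDiagram {n} D =
  ((α : Arc n) → α ∈ D → ValidArc α) ×
  ((i j : Fin (length D)) → i ≢ j →
     let α = List.lookup D i ; β = List.lookup D j in
     lo α ≢ lo β × hi α ≢ hi β × ¬ Cross α β)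

_≈D_ : {n : ℕ} → Diagram n → Diagram n → Set
_≈D_ {n} D E =
  ((α : Arc n) → α ∈ D → Σ (Arc n) λ β → β ∈ E × α ≈a β) ×
  ((β : Arc n) → β ∈ E → Σ (Arc n) λ α → α ∈ D × α ≈a β)

Descent : {n : ℕ} → Vec (Fin n) n → Fin n → Fin n → Set
Descent x i j = toℕ j ≡ suc (toℕ i) × lookup x j Fin.< lookup x i

ArcOf : {n : ℕ} → Vec (Fin n) n → Arc n → Set
ArcOf {n} x α =
  Σ (Fin n) λ i → Σ (Fin n) λ j →
    Descent x i j ×
    ((i′ j′ : Fin n) → Descent x i′ j′ → i′ ≡ i) ×
    lo α ≡ lookup x j × hi α ≡ lookup x i ×
    ((c : Fin n) → lo α Fin.< c → c Fin.< hi α →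
       (lookup (left α) c ≡ true ⇔ (Σ (Fin n) λ k → k Fin.≤ i × lookup x k ≡ c)))

-- The map δ, as a relation:  Delta x D  iff  D is (a representative of)
-- δ(x), the set of arcs of the join-irreducibles in the canonical join
-- representation of x.

Delta : {n : ℕ} → Vec (Fin n) n → Diagram n → Set
Delta {n} x D =
  Σ (List (Vec (Fin n) n)) λ S →
    IsCanonicalJoinRep x S ×
    ((α : Arc n) → α ∈ D → Σ (Vec (Fin n) n) λ s → s ∈ S × ArcOf s α) ×
    ((s : Vec (Fin n) n) → s ∈ S → Σ (Arc n) λ α → α ∈ D × ArcOf s α)

-- The canonical join representation of a permutation x in the weak order consists of the
-- join-irreducible permutations of the arcs of its descents: x is their join, since every inversion of
-- x splits into inversions each separated by a single descent; none of them can be dropped, since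
-- undoing one descent gives an upper bound of the others that is not above x; and every other join
-- representation of x refines them. A join-irreducible is determined by its arc, so δ is well defined
-- and injective, and the arcs of different descents do not cross. Conversely, a noncrossing diagram is
-- realized letter by letter: its least source, a letter that can come first, is listed first, followed
-- by a permutation realizing the diagram without that letter and the arcs ending at it.

module Submission where

open import Defs
open import Data.Bool using (Bool; true; false; if_then_else_)
import Data.Bool.Properties as BoolP
open import Data.Empty using (⊥-elim)
open import Data.Fin as F using (Fin; zero; suc; toℕ; fromℕ<; punchIn; punchOut; _<_; _≤_)
import Data.Fin.Properties as FP
open import Data.Fin.Subset as Sub using (Subset; ∣_∣; _⊂_)
open import Data.Fin.Subset.Properties using (∈⊤; ∣⊤∣≡n; p⊂q⇒∣p∣<∣q∣)
open import Data.List as L using (List; []; _∷_)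
import Data.List.Membership.DecPropositional as DecMembership
open import Data.List.Membership.Propositional using (_∈_; _∉_; find; lose)
import Data.List.Membership.Propositional.Properties as ∈P
open import Data.List.Relation.Binary.Subset.Propositional using (_⊆_)
import Data.List.Relation.Unary.All as All
open import Data.List.Relation.Unary.All.Properties using (¬All⇒Any¬)
open import Data.List.Relation.Unary.AllPairs using (AllPairs; []; _∷_)
import Data.List.Relation.Unary.AllPairs.Properties as AllPairs
import Data.List.Relation.Unary.Any as Any
open import Data.List.Relation.Unary.Any using (here; there)
open import Data.List.Relation.Unary.Any.Properties using (lookup-index)
open import Data.List.Relation.Unary.Unique.Propositional using (Unique)
import Data.List.Relation.Unary.Unique.Propositional.Properties as UniqueP
open import Data.Nat as ℕ using (ℕ; zero; suc; z≤n; s≤s; _+_; _∸_)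
open import Data.Nat.Induction using (<-rec)
import Data.Nat.Properties as ℕP
open import Data.Product using (Σ; ∃; _×_; _,_; proj₁; proj₂)
open import Data.Sum using (_⊎_; inj₁; inj₂)
open import Data.Vec as V using (Vec; []; _∷_; lookup; tabulate)
import Data.Vec.Properties as VP
open import Function using (_∘_; _⇔_; mk⇔; Equivalence; case_of_)
open import Function.Properties.Equivalence using () renaming (trans to ⇔-trans; sym to ⇔-sym)
open import Relation.Binary using (Tri; tri<; tri≈; tri>)
open import Relation.Binary.PropositionalEquality using (_≡_; _≢_; refl; sym; trans; cong; subst; subst₂)
open import Relation.Nullary using (¬_; Dec; yes; no; does; contradiction; ¬?)
open import Relation.Nullary.Decidable using (_×-dec_; _→-dec_; map′; decidable-stable; dec-true; dec-false)
open import Relation.Unary using (Pred; Decidable)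

Word : ℕ → Set
Word n = Vec (Fin n) n

does⇔ : ∀ {a} {A : Set a} (a? : Dec A) → does a? ≡ true ⇔ A
does⇔ (yes a) = mk⇔ (λ _ → a) (λ _ → refl)
does⇔ (no ¬a) = mk⇔ (λ ()) (λ a → contradiction a ¬a)

counterexample : ∀ {a p} {A : Set a} {P : A → Set p} → Decidable P → (xs : List A) →
                 ¬ (∀ {x} → x ∈ xs → P x) → ∃ λ x → x ∈ xs × ¬ P x
counterexample P? xs ¬all = find (¬All⇒Any¬ P? xs (¬all ∘ All.lookup))

∀∈? : ∀ {a p} {A : Set a} {P : A → Set p} → Decidable P → (xs : List A) → Dec (∀ x → x ∈ xs → P x)
∀∈? P? xs = map′ (λ all x → All.lookup all) (λ all → All.tabulate (all _)) (All.all? P? xs)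

∃∈? : ∀ {a p} {A : Set a} {P : A → Set p} → Decidable P → (xs : List A) → Dec (∃ λ x → x ∈ xs × P x)
∃∈? P? xs = map′ find (λ (_ , x∈ , px) → lose x∈ px) (Any.any? P? xs)

filter-AllPairs : ∀ {a p r} {A : Set a} {P : A → Set p} {R : A → A → Set r} (P? : Decidable P) →
                  (∀ {x y} → P x → P y → x ≢ y → R x y) → ∀ {xs} → Unique xs → AllPairs R (L.filter P? xs)
filter-AllPairs P? r [] = []
filter-AllPairs P? r {x ∷ xs} (x∉xs ∷ unique) with P? x
... | yes px = All.tabulate (λ y∈ → let y∈xs , py = ∈P.∈-filter⁻ P? {xs = xs} y∈ in r px py (All.lookup x∉xs y∈xs))
               ∷ filter-AllPairs P? r unique
... | no _   = filter-AllPairs P? r unique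

AllPairs-lookup : ∀ {a r} {A : Set a} {R : A → A → Set r} {xs : List A} → AllPairs R xs →
                  ∀ {p q} → p ≢ q → R (L.lookup xs p) (L.lookup xs q) ⊎ R (L.lookup xs q) (L.lookup xs p)
AllPairs-lookup (_ ∷ _) {zero} {zero} p≢q = contradiction refl p≢q
AllPairs-lookup (r ∷ _) {zero} {suc q} _ = inj₁ (All.lookup r (∈P.∈-lookup q))
AllPairs-lookup (r ∷ _) {suc p} {zero} _ = inj₂ (All.lookup r (∈P.∈-lookup p))
AllPairs-lookup (_ ∷ rs) {suc p} {suc q} p≢q = AllPairs-lookup rs (p≢q ∘ cong suc)

least : ∀ {n p} {P : Pred (Fin n) p} → Decidable P → ∃ P → ∃ λ c → P c × (∀ d → d < c → ¬ P d)
least {suc n} P? w with P? zero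
... | yes p₀ = zero , p₀ , λ _ ()
least {suc n} P? (zero , p₀) | no ¬p₀ = contradiction p₀ ¬p₀
least {suc n} P? (suc c , pc) | no ¬p₀ with least (P? ∘ suc) (c , pc)
... | m , pm , below = suc m , pm , λ { zero _ → ¬p₀ ; (suc d) (s≤s d<m) → below d d<m }

greatest : ∀ {n p} {P : Pred (Fin n) p} → Decidable P → ∃ P → ∃ λ c → P c × (∀ d → c < d → ¬ P d)
greatest {suc n} P? w with FP.any? (P? ∘ suc)
... | yes w′ with greatest (P? ∘ suc) w′
...   | m , pm , above = suc m , pm , λ { (suc d) (s≤s m<d) → above d m<d }
greatest {suc n} P? (zero , p₀) | no none = zero , p₀ , λ { (suc d) _ pd → none (d , pd) }
greatest {suc n} P? (suc c , pc) | no none = contradiction (c , pc) none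

Adjacent : ∀ {n} → Fin n → Fin n → Set
Adjacent i j = toℕ j ≡ suc (toℕ i)

next : ∀ {n} (i j : Fin n) → i < j → Fin n
next i j i<j = fromℕ< (ℕP.<-≤-trans (s≤s i<j) (FP.toℕ<n j))

adjacent-next : ∀ {n} (i j : Fin n) (i<j : i < j) → Adjacent i (next i j i<j)
adjacent-next i j i<j = FP.toℕ-fromℕ< _

next≤ : ∀ {n} (i j : Fin n) (i<j : i < j) → next i j i<j ≤ j
next≤ i j i<j = subst (ℕ._≤ toℕ j) (sym (adjacent-next i j i<j)) i<j

adjacent⇒< : ∀ {n} {i j : Fin n} → Adjacent i j → i < j
adjacent⇒< {i = i} adj = subst (toℕ i ℕ.<_) (sym adj) (ℕP.n<1+n (toℕ i))

adjacent-gap : ∀ {n} {i j k : Fin n} → Adjacent i j → i < k → j ≤ k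
adjacent-gap {i = i} {k = k} adj i<k = subst (ℕ._≤ toℕ k) (sym adj) i<k

adjacent-unique : ∀ {n} {i j j′ : Fin n} → Adjacent i j → Adjacent i j′ → j ≡ j′
adjacent-unique adj adj′ = FP.toℕ-injective (trans adj (sym adj′))

adjacent-uniqueˡ : ∀ {n} {i i′ j : Fin n} → Adjacent i j → Adjacent i′ j → i ≡ i′
adjacent-uniqueˡ adj adj′ = FP.toℕ-injective (ℕP.suc-injective (trans (sym adj) adj′))

step-between : ∀ {n p} {P : Pred (Fin n) p} → Decidable P → ∀ {k m} → k ≤ m → P k → ¬ P m →
               ∃ λ t → ∃ λ t′ → Adjacent t t′ × k ≤ t × t′ ≤ m × P t × ¬ P t′
step-between {P = P} P? {k} {m} k≤m pk ¬pm
  with greatest (λ t → (k F.≤? t) ×-dec (t F.≤? m) ×-dec P? t) (k , FP.≤-refl , k≤m , pk)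
... | t , (k≤t , t≤m , pt) , above = t , t′ , adjacent-next t m t<m , k≤t , next≤ t m t<m , pt ,
        λ pt′ → above t′ (adjacent⇒< (adjacent-next t m t<m))
                  (ℕP.≤-trans k≤t (ℕP.<⇒≤ (adjacent⇒< (adjacent-next t m t<m))) , next≤ t m t<m , pt′)
  where
  t<m : t < m
  t<m = FP.≤∧≢⇒< t≤m (λ { refl → ¬pm pt })
  t′ = next t m t<m

punchIn-mono-< : ∀ {n} (p : Fin (suc n)) {a b : Fin n} → a < b → punchIn p a < punchIn p b
punchIn-mono-< p {a} {b} a<b = FP.≤∧≢⇒< (FP.punchIn-mono-≤ p a b (ℕP.<⇒≤ a<b)) (FP.<⇒≢ a<b ∘ FP.punchIn-injective p a b)

punchIn-surjective : ∀ {n} (p : Fin (suc n)) {c} → c ≢ p → ∃ λ c′ → punchIn p c′ ≡ c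
punchIn-surjective p c≢p = punchOut (c≢p ∘ sym) , FP.punchIn-punchOut (c≢p ∘ sym)

punchIn-cancel-< : ∀ {n} (p : Fin (suc n)) {a b : Fin n} → punchIn p a < punchIn p b → a < b
punchIn-cancel-< p {a} {b} lt = ℕP.≰⇒> λ b≤a → ℕP.<⇒≱ lt (FP.punchIn-mono-≤ p b a b≤a)

injective⇒surjective : ∀ {n} (f : Fin n → Fin n) → (∀ i j → f i ≡ f j → i ≡ j) → ∀ c → ∃ λ k → f k ≡ c
injective⇒surjective {zero} f inj ()
injective⇒surjective {suc n} f inj c with FP.any? (λ k → f k F.≟ c)
... | yes hit = hit
... | no miss with FP.pigeonhole (ℕP.n<1+n n) (λ k → punchOut {i = c} {j = f k} (λ c≡fk → miss (k , sym c≡fk)))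
...   | i , j , i<j , eq = contradiction (inj i j (FP.punchOut-injective {i = c} _ _ eq)) (FP.<⇒≢ i<j)

Precedes : ∀ {n} → Word n → Fin n → Fin n → Set
Precedes {n} x c d = Σ (Fin n) λ k → Σ (Fin n) λ m → k < m × lookup x k ≡ c × lookup x m ≡ d

Inv⇒Precedes : ∀ {n} (x : Word n) {a b} → Inv x a b → Precedes x a b
Inv⇒Precedes _ (k , m , k<m , xk , xm , _) = k , m , k<m , xk , xm

Inv⇒> : ∀ {n} (x : Word n) {a b} → Inv x a b → b < a
Inv⇒> _ (_ , _ , _ , _ , _ , b<a) = b<a

Precedes⇒Inv : ∀ {n} (x : Word n) {a b} → Precedes x a b → b < a → Inv x a b
Precedes⇒Inv _ (k , m , k<m , xk , xm) b<a = k , m , k<m , xk , xm , b<a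

module _ {n : ℕ} (x : Word n) (px : IsPerm x) where

  position : Fin n → Fin n
  position c = proj₁ (injective⇒surjective (lookup x) px c)

  lookup-position : ∀ c → lookup x (position c) ≡ c
  lookup-position c = proj₂ (injective⇒surjective (lookup x) px c)

  position-unique : ∀ {k c} → lookup x k ≡ c → position c ≡ k
  position-unique {k} eq = px _ _ (trans (lookup-position _) (sym eq))

  position-injective : ∀ {c d} → toℕ (position c) ≡ toℕ (position d) → c ≡ d
  position-injective {c} {d} eq = trans (sym (lookup-position c)) (trans (cong (lookup x) (FP.toℕ-injective eq)) (lookup-position d))

  position⇒Precedes : ∀ {c d} → position c < position d → Precedes x c d
  position⇒Precedes lt = _ , _ , lt , lookup-position _ , lookup-position _

  Precedes⇒position : ∀ {c d} → Precedes x c d → position c < position d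
  Precedes⇒position (k , m , k<m , refl , refl)
    rewrite position-unique {k} refl | position-unique {m} refl = k<m

  Precedes-trans : ∀ {c d e} → Precedes x c d → Precedes x d e → Precedes x c e
  Precedes-trans p q = position⇒Precedes (FP.<-trans (Precedes⇒position p) (Precedes⇒position q))

  Precedes-irrefl : ∀ {c} → ¬ Precedes x c c
  Precedes-irrefl p = FP.<-irrefl refl (Precedes⇒position p)

  Precedes-asym : ∀ {c d} → Precedes x c d → ¬ Precedes x d c
  Precedes-asym p q = Precedes-irrefl (Precedes-trans p q)

  Precedes-total : ∀ c d → c ≢ d → Precedes x c d ⊎ Precedes x d c
  Precedes-total c d c≢d with FP.<-cmp (position c) (position d)
  ... | tri< lt _ _ = inj₁ (position⇒Precedes lt)
  ... | tri≈ _ eq _ = contradiction (position-injective (cong toℕ eq)) c≢d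
  ... | tri> _ _ gt = inj₂ (position⇒Precedes gt)

≤w-trans : ∀ {n} {x y z : Word n} → x ≤w y → y ≤w z → x ≤w z
≤w-trans x≤y y≤z a b = y≤z a b ∘ x≤y a b

≤w⇒Precedes : ∀ {n} (x y : Word n) → IsPerm x → IsPerm y → x ≤w y →
              ∀ {a b} → a < b → Precedes y a b → Precedes x a b
≤w⇒Precedes x y px py x≤y {a} {b} a<b pre with Precedes-total x px a b (FP.<⇒≢ a<b)
... | inj₁ pre′ = pre′
... | inj₂ pre′ = contradiction (Inv⇒Precedes y (x≤y b a (Precedes⇒Inv x pre′ a<b))) (Precedes-asym y py pre)

-- At the first position k where x and y differ, x_k precedes y_k in x but follows it in y.
Precedes-injective : ∀ {n} (x y : Word n) → IsPerm x → IsPerm y →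
                     (∀ {c d} → Precedes x c d → Precedes y c d) → x ≡ y
Precedes-injective {n} x y px py same =
  trans (sym (VP.tabulate∘lookup x)) (trans (VP.tabulate-cong agree) (VP.tabulate∘lookup y))
  where
  agree : ∀ k → lookup x k ≡ lookup y k
  agree k with lookup x k F.≟ lookup y k
  ... | yes eq = eq
  ... | no neq with least (λ k → ¬? (lookup x k F.≟ lookup y k)) (k , neq)
  ...   | k₀ , differ , before = ⊥-elim (
    Precedes-asym y py (same (k₀ , _ , later {x} {y} px py differ agreeBefore , refl , lookup-position x px _))
                     (k₀ , _ , later {y} {x} py px (differ ∘ sym) (λ d → sym ∘ agreeBefore d) , refl , lookup-position y py _))
    where
    agreeBefore : ∀ d → d < k₀ → lookup x d ≡ lookup y d
    agreeBefore d d<k₀ = decidable-stable (lookup x d F.≟ lookup y d) (before d d<k₀)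
    later : ∀ {u v : Word n} (pu : IsPerm u) → IsPerm v → lookup u k₀ ≢ lookup v k₀ →
            (∀ d → d < k₀ → lookup u d ≡ lookup v d) → k₀ < position u pu (lookup v k₀)
    later {u} {v} pu pv differ agree with FP.<-cmp k₀ (position u pu (lookup v k₀))
    ... | tri< lt _ _ = lt
    ... | tri≈ _ eq _ = contradiction (trans (cong (lookup u) eq) (lookup-position u pu _)) differ
    ... | tri> _ _ gt = contradiction gt (FP.<-irrefl (pv _ _ (trans (sym (agree _ gt)) (lookup-position u pu _))))

≤w-antisym : ∀ {n} (x y : Word n) → IsPerm x → IsPerm y → x ≤w y → y ≤w x → x ≡ y
≤w-antisym x y px py x≤y y≤x = Precedes-injective x y px py same
  where
  same : ∀ {c d} → Precedes x c d → Precedes y c d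
  same {c} {d} pre with FP.<-cmp c d
  ... | tri< c<d _ _ = ≤w⇒Precedes y x py px y≤x c<d pre
  ... | tri≈ _ refl _ = contradiction pre (Precedes-irrefl x px)
  ... | tri> _ _ d<c = Inv⇒Precedes y (x≤y c d (Precedes⇒Inv x pre d<c))

module _ {n : ℕ} (x : Word n) (px : IsPerm x) where

  -- such an e would sit strictly between positions i and j
  adjacent-no-between : ∀ {i j e} → Adjacent i j → Precedes x (lookup x i) e → ¬ Precedes x e (lookup x j)
  adjacent-no-between {i} {j} adj (k , m , k<m , xk , refl) (m′ , l , m′<l , xm′ , xl)
    with px k i xk | px l j xl | px m′ m xm′
  ... | refl | refl | refl = ℕP.<-irrefl refl (ℕP.<-≤-trans m′<l (adjacent-gap adj k<m))

  Precedes⇒adjacent : ∀ {c d} → Precedes x c d → (∀ e → Precedes x c e → ¬ Precedes x e d) →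
                      Adjacent (position x px c) (position x px d)
  Precedes⇒adjacent {c} {d} pre nothing-between with toℕ (position x px d) ℕ.≟ suc (toℕ (position x px c))
  ... | yes adj = adj
  ... | no ¬adj = ⊥-elim (nothing-between (lookup x m) (p , m , p<m , lookup-position x px c , refl)
                                               (m , q , m<q , refl , lookup-position x px d))
    where
    p = position x px c
    q = position x px d
    p<q = Precedes⇒position x px pre
    m = next p q p<q
    p<m : p < m
    p<m = adjacent⇒< (adjacent-next p q p<q)
    m<q : m < q
    m<q = FP.≤∧≢⇒< (next≤ p q p<q) (λ m≡q → ¬adj (trans (cong toℕ (sym m≡q)) (adjacent-next p q p<q)))

module SortBy {n : ℕ} (key : Fin n → ℕ) (key-injective : ∀ c d → key c ≡ key d → c ≡ d) where

  _≺_ : Fin n → Fin n → Set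
  c ≺ d = key c ℕ.< key d

  ≺-total : ∀ c d → c ≢ d → c ≺ d ⊎ d ≺ c
  ≺-total c d c≢d with ℕP.<-cmp (key c) (key d)
  ... | tri< lt _ _ = inj₁ lt
  ... | tri≈ _ eq _ = contradiction (key-injective c d eq) c≢d
  ... | tri> _ _ gt = inj₂ gt

  predecessors : Fin n → Subset n
  predecessors c = tabulate (λ d → does (key d ℕ.<? key c))

  ∈-predecessors⁺ : ∀ {c d} → d ≺ c → d Sub.∈ predecessors c
  ∈-predecessors⁺ {c} {d} d≺c = VP.lookup⇒[]= d _
    (trans (VP.lookup∘tabulate (λ e → does (key e ℕ.<? key c)) d) (Equivalence.from (does⇔ (key d ℕ.<? key c)) d≺c))

  ∈-predecessors⁻ : ∀ {c d} → d Sub.∈ predecessors c → d ≺ c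
  ∈-predecessors⁻ {c} {d} d∈ = Equivalence.to (does⇔ (key d ℕ.<? key c))
    (trans (sym (VP.lookup∘tabulate (λ e → does (key e ℕ.<? key c)) d)) (VP.[]=⇒lookup d∈))

  ∉-predecessors : ∀ c → c Sub.∉ predecessors c
  ∉-predecessors c = ℕP.<-irrefl refl ∘ ∈-predecessors⁻

  predecessors-⊂ : ∀ {c d} → c ≺ d → predecessors c ⊂ predecessors d
  predecessors-⊂ {c} {d} c≺d =
    (λ e∈ → ∈-predecessors⁺ (ℕP.<-trans (∈-predecessors⁻ e∈) c≺d)) , c , ∈-predecessors⁺ c≺d , ∉-predecessors c

  rank : Fin n → Fin n
  rank c = fromℕ< (subst (∣ predecessors c ∣ ℕ.<_) (∣⊤∣≡n n) (p⊂q⇒∣p∣<∣q∣ ((λ _ → ∈⊤) , c , ∈⊤ , ∉-predecessors c)))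

  rank-mono : ∀ {c d} → c ≺ d → rank c < rank d
  rank-mono c≺d = subst₂ ℕ._<_ (sym (FP.toℕ-fromℕ< _)) (sym (FP.toℕ-fromℕ< _)) (p⊂q⇒∣p∣<∣q∣ (predecessors-⊂ c≺d))

  rank-injective : ∀ c d → rank c ≡ rank d → c ≡ d
  rank-injective c d eq with c F.≟ d
  ... | yes c≡d = c≡d
  ... | no c≢d with ≺-total c d c≢d
  ...   | inj₁ c≺d = contradiction eq (FP.<⇒≢ (rank-mono c≺d))
  ...   | inj₂ d≺c = contradiction (sym eq) (FP.<⇒≢ (rank-mono d≺c))

  -- opaque, so that unifying with sorted never unfolds the inverse of rank
  opaque
    sorted : Word n
    sorted = tabulate (proj₁ ∘ injective⇒surjective rank rank-injective)

    rank-lookup-sorted : ∀ k → rank (lookup sorted k) ≡ k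
    rank-lookup-sorted k = trans (cong rank (VP.lookup∘tabulate _ k)) (proj₂ (injective⇒surjective rank rank-injective k))

  lookup-sorted : ∀ c → lookup sorted (rank c) ≡ c
  lookup-sorted c = rank-injective _ _ (rank-lookup-sorted (rank c))

  sorted-perm : IsPerm sorted
  sorted-perm i j eq = trans (sym (rank-lookup-sorted i)) (trans (cong rank eq) (rank-lookup-sorted j))

  ≺⇒Precedes : ∀ {c d} → c ≺ d → Precedes sorted c d
  ≺⇒Precedes c≺d = rank _ , rank _ , rank-mono c≺d , lookup-sorted _ , lookup-sorted _

  Precedes⇒≺ : ∀ {c d} → Precedes sorted c d → c ≺ d
  Precedes⇒≺ {c} {d} pre with c F.≟ d
  ... | yes refl = contradiction pre (Precedes-irrefl sorted sorted-perm)
  ... | no c≢d with ≺-total c d c≢d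
  ...   | inj₁ c≺d = c≺d
  ...   | inj₂ d≺c = contradiction (≺⇒Precedes d≺c) (Precedes-asym sorted sorted-perm pre)

-- the permutation listing the letters c with U c ≡ true increasingly, then the others increasingly
module FrontFirst {n : ℕ} (U : Fin n → Bool) where

  -- opaque, so that c and d can be inferred from key c ℕ.< key d
  opaque
    key : Fin n → ℕ
    key c = if U c then toℕ c else n + toℕ c

    key-injective : ∀ c d → key c ≡ key d → c ≡ d
    key-injective c d eq with U c | U d
    ... | true  | true  = FP.toℕ-injective eq
    ... | false | false = FP.toℕ-injective (ℕP.+-cancelˡ-≡ n _ _ eq)
    ... | true  | false = contradiction (subst (ℕ._< n) eq (FP.toℕ<n c)) (ℕP.≤⇒≯ (ℕP.m≤m+n n (toℕ d)))
    ... | false | true  = contradiction (subst (ℕ._< n) (sym eq) (FP.toℕ<n d)) (ℕP.≤⇒≯ (ℕP.m≤m+n n (toℕ c)))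

    front≺back : ∀ {c d} → U c ≡ true → U d ≡ false → key c ℕ.< key d
    front≺back {c} {d} Uc Ud rewrite Uc | Ud = ℕP.<-≤-trans (FP.toℕ<n c) (ℕP.m≤m+n n (toℕ d))

    same-side-≺ : ∀ {c d} → U c ≡ U d → c < d → key c ℕ.< key d
    same-side-≺ {c} {d} eq c<d with U c | U d
    same-side-≺ refl c<d | true  | true  = c<d
    same-side-≺ refl c<d | false | false = ℕP.+-monoʳ-< n c<d

    ≺-descent : ∀ {c d} → key c ℕ.< key d → d < c → U c ≡ true × U d ≡ false
    ≺-descent {c} {d} c≺d d<c with U c | U d
    ... | true  | false = refl , refl
    ... | true  | true  = contradiction c≺d (ℕP.<⇒≯ d<c)
    ... | false | false = contradiction c≺d (ℕP.<⇒≯ (ℕP.+-monoʳ-< n d<c))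
    ... | false | true  = contradiction c≺d (ℕP.<⇒≯ (ℕP.<-≤-trans (FP.toℕ<n d) (ℕP.m≤m+n n (toℕ c))))

  open SortBy key key-injective public

  Inv-sorted⁻ : ∀ {a b} → Inv sorted a b → U a ≡ true × U b ≡ false
  Inv-sorted⁻ inv = ≺-descent (Precedes⇒≺ (Inv⇒Precedes sorted inv)) (Inv⇒> sorted inv)

  Inv-sorted⁺ : ∀ {a b} → b < a → U a ≡ true → U b ≡ false → Inv sorted a b
  Inv-sorted⁺ b<a Ua Ub = Precedes⇒Inv sorted (≺⇒Precedes (front≺back Ua Ub)) b<a

-- The join-irreducible permutation of an arc

-- front α c: whether c is listed before the descent of the join-irreducible permutation of α
front : ∀ {n} → Arc n → Fin n → Bool
front α c with FP.<-cmp c (lo α) | FP.<-cmp c (hi α)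
... | tri< _ _ _ | _          = true
... | tri≈ _ _ _ | _          = false
... | tri> _ _ _ | tri< _ _ _ = lookup (left α) c
... | tri> _ _ _ | tri≈ _ _ _ = true
... | tri> _ _ _ | tri> _ _ _ = false

module _ {n : ℕ} (α : Arc n) where

  front-below : ∀ {c} → c < lo α → front α c ≡ true
  front-below {c} c<lo with FP.<-cmp c (lo α) | FP.<-cmp c (hi α)
  ... | tri< _ _ _ | _ = refl
  ... | tri≈ c≮lo _ _ | _ = contradiction c<lo c≮lo
  ... | tri> c≮lo _ _ | _ = contradiction c<lo c≮lo

  front-lo : front α (lo α) ≡ false
  front-lo with FP.<-cmp (lo α) (lo α) | FP.<-cmp (lo α) (hi α)
  ... | tri≈ _ _ _ | _ = refl
  ... | tri< _ ≢ _ | _ = contradiction refl ≢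
  ... | tri> _ ≢ _ | _ = contradiction refl ≢

  front-between : ∀ {c} → lo α < c → c < hi α → front α c ≡ lookup (left α) c
  front-between {c} lo<c c<hi with FP.<-cmp c (lo α) | FP.<-cmp c (hi α)
  ... | tri> _ _ _ | tri< _ _ _ = refl
  ... | tri< _ _ c≯lo | _ = contradiction lo<c c≯lo
  ... | tri≈ _ _ c≯lo | _ = contradiction lo<c c≯lo
  ... | tri> _ _ _ | tri≈ c≮hi _ _ = contradiction c<hi c≮hi
  ... | tri> _ _ _ | tri> c≮hi _ _ = contradiction c<hi c≮hi

  front-hi : ValidArc α → front α (hi α) ≡ true
  front-hi lo<hi with FP.<-cmp (hi α) (lo α) | FP.<-cmp (hi α) (hi α)
  ... | tri> _ _ _ | tri≈ _ _ _ = refl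
  ... | tri< _ _ hi≯lo | _ = contradiction lo<hi hi≯lo
  ... | tri≈ _ _ hi≯lo | _ = contradiction lo<hi hi≯lo
  ... | tri> _ _ _ | tri< _ ≢ _ = contradiction refl ≢
  ... | tri> _ _ _ | tri> _ ≢ _ = contradiction refl ≢

  front-above : ∀ {c} → ValidArc α → hi α < c → front α c ≡ false
  front-above {c} lo<hi hi<c with FP.<-cmp c (lo α) | FP.<-cmp c (hi α)
  ... | tri> _ _ _ | tri> _ _ _ = refl
  ... | tri< _ _ c≯lo | _ = contradiction (FP.<-trans lo<hi hi<c) c≯lo
  ... | tri≈ _ _ c≯lo | _ = contradiction (FP.<-trans lo<hi hi<c) c≯lo
  ... | tri> _ _ _ | tri< _ _ c≯hi = contradiction hi<c c≯hi
  ... | tri> _ _ _ | tri≈ _ _ c≯hi = contradiction hi<c c≯hi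

  front-true : ∀ {c} → front α c ≡ true →
               c < lo α ⊎ (lo α < c × c < hi α × lookup (left α) c ≡ true) ⊎ c ≡ hi α
  front-true {c} eq with FP.<-cmp c (lo α) | FP.<-cmp c (hi α)
  ... | tri< c<lo _ _ | _          = inj₁ c<lo
  ... | tri> _ _ lo<c | tri< c<hi _ _ = inj₂ (inj₁ (lo<c , c<hi , eq))
  ... | tri> _ _ _    | tri≈ _ c≡hi _ = inj₂ (inj₂ c≡hi)

  front-false : ∀ {c} → front α c ≡ false →
                c ≡ lo α ⊎ (lo α < c × c < hi α × lookup (left α) c ≡ false) ⊎ hi α < c
  front-false {c} eq with FP.<-cmp c (lo α) | FP.<-cmp c (hi α)
  ... | tri≈ _ c≡lo _ | _          = inj₁ c≡lo
  ... | tri> _ _ lo<c | tri< c<hi _ _ = inj₂ (inj₁ (lo<c , c<hi , eq))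
  ... | tri> _ _ _    | tri> _ _ hi<c = inj₂ (inj₂ hi<c)

≈a-front : ∀ {n} {α β : Arc n} → α ≈a β → ∀ c → front α c ≡ front β c
≈a-front {α = arc l h L} {arc .l .h L′} (refl , refl , lefts) c with FP.<-cmp c l | FP.<-cmp c h
... | tri< _ _ _ | _ = refl
... | tri≈ _ _ _ | _ = refl
... | tri> _ _ l<c | tri< c<h _ _ = BoolP.⇔→≡ (lefts c l<c c<h)
... | tri> _ _ _ | tri≈ _ _ _ = refl
... | tri> _ _ _ | tri> _ _ _ = refl

joinIrreducible : ∀ {n} → Arc n → Word n
joinIrreducible α = FrontFirst.sorted (front α)

joinIrreducible-perm : ∀ {n} (α : Arc n) → IsPerm (joinIrreducible α)
joinIrreducible-perm α = FrontFirst.sorted-perm (front α)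

module _ {n : ℕ} (α : Arc n) (lo<hi : ValidArc α) where

  open FrontFirst (front α)

  private
    Jα = joinIrreducible α
    pJα = joinIrreducible-perm α
    pos = position Jα pJα

    below-hi : ∀ {c} → front α c ≡ true → c ≢ hi α → c ≺ hi α
    below-hi {c} fc c≢hi = same-side-≺ (trans fc (sym (front-hi α lo<hi))) c<hi
      where
      c<hi : c < hi α
      c<hi with front-true α {c} fc
      ... | inj₁ c<lo = FP.<-trans c<lo lo<hi
      ... | inj₂ (inj₁ (_ , c<hi , _)) = c<hi
      ... | inj₂ (inj₂ c≡hi) = contradiction c≡hi c≢hi

    hi≺lo : hi α ≺ lo α
    hi≺lo = front≺back (front-hi α lo<hi) (front-lo α)

    lo-not-before-above : ∀ e → front α e ≡ false → lo α < e → ¬ Precedes Jα e (lo α)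
    lo-not-before-above e fe lo<e e≺lo = ℕP.<-asym (Precedes⇒≺ e≺lo) (same-side-≺ (trans (front-lo α) (sym fe)) lo<e)

    nothing-between : ∀ e → Precedes Jα (hi α) e → ¬ Precedes Jα e (lo α)
    nothing-between e hi≺e e≺lo with front α e in fe
    ... | true  = ℕP.<-asym (Precedes⇒≺ hi≺e) (below-hi fe (λ { refl → Precedes-irrefl Jα pJα hi≺e }))
    ... | false with front-false α {e} fe
    ...   | inj₁ refl = Precedes-irrefl Jα pJα e≺lo
    ...   | inj₂ (inj₁ (lo<e , _)) = lo-not-before-above e fe lo<e e≺lo
    ...   | inj₂ (inj₂ hi<e) = lo-not-before-above e fe (FP.<-trans lo<hi hi<e) e≺lo

    descent : Descent Jα (pos (hi α)) (pos (lo α))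
    descent = Precedes⇒adjacent Jα pJα (≺⇒Precedes hi≺lo) nothing-between ,
              subst₂ _<_ (sym (lookup-position Jα pJα _)) (sym (lookup-position Jα pJα _)) lo<hi

    unique-descent : ∀ i j → Descent Jα i j → i ≡ pos (hi α)
    unique-descent i j (adj , xj<xi) with ≺-descent (Precedes⇒≺ (i , j , adjacent⇒< adj , refl , refl)) xj<xi
    ... | fi , fj with lookup Jα i F.≟ hi α
    ...   | yes xi≡hi = sym (position-unique Jα pJα xi≡hi)
    ...   | no xi≢hi = contradiction (≺⇒Precedes (front≺back (front-hi α lo<hi) fj))
                         (adjacent-no-between Jα pJα adj (≺⇒Precedes (below-hi fi xi≢hi)))

    left-before-descent : ∀ c → lo α < c → c < hi α →
                          lookup (left α) c ≡ true ⇔ (Σ (Fin n) λ k → k ≤ pos (hi α) × lookup Jα k ≡ c)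
    left-before-descent c lo<c c<hi = mk⇔ before isLeft
      where
      before : lookup (left α) c ≡ true → Σ (Fin n) λ k → k ≤ pos (hi α) × lookup Jα k ≡ c
      before lc = pos c , ℕP.<⇒≤ (Precedes⇒position Jα pJα (≺⇒Precedes
                    (below-hi (trans (front-between α lo<c c<hi) lc) (FP.<⇒≢ c<hi)))) , lookup-position Jα pJα c
      isLeft : (Σ (Fin n) λ k → k ≤ pos (hi α) × lookup Jα k ≡ c) → lookup (left α) c ≡ true
      isLeft (k , k≤ , refl) with front α (lookup Jα k) in fc
      ... | true  = trans (sym (front-between α lo<c c<hi)) fc
      ... | false = contradiction (ℕP.≤-<-trans k≤ (subst (pos (hi α) <_) (position-unique Jα pJα refl)
                      (Precedes⇒position Jα pJα (≺⇒Precedes (front≺back {hi α} {lookup Jα k} (front-hi α lo<hi) fc))))) (ℕP.<-irrefl refl)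

  joinIrreducible-ArcOf : ArcOf Jα α
  joinIrreducible-ArcOf = pos (hi α) , pos (lo α) , descent , unique-descent ,
                          sym (lookup-position Jα pJα _) , sym (lookup-position Jα pJα _) , left-before-descent

Inv-joinIrreducible⁻ : ∀ {n} (α : Arc n) {a b} → Inv (joinIrreducible α) a b → front α a ≡ true × front α b ≡ false
Inv-joinIrreducible⁻ α = FrontFirst.Inv-sorted⁻ (front α)

Inv-joinIrreducible⁺ : ∀ {n} (α : Arc n) {a b} → b < a → front α a ≡ true → front α b ≡ false → Inv (joinIrreducible α) a b
Inv-joinIrreducible⁺ α = FrontFirst.Inv-sorted⁺ (front α)

LeftOfDescent : ∀ {n} → Word n → Fin n → Arc n → Set
LeftOfDescent {n} x i α = (c : Fin n) → lo α < c → c < hi α →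
  (lookup (left α) c ≡ true ⇔ Σ (Fin n) λ k → k ≤ i × lookup x k ≡ c)

DescentArc : ∀ {n} → Word n → Fin n → Arc n → Set
DescentArc {n} x i α = Σ (Fin n) λ j → Descent x i j × lo α ≡ lookup x j × hi α ≡ lookup x i × LeftOfDescent x i α

DescentArc-valid : ∀ {n} (x : Word n) {i α} → DescentArc x i α → ValidArc α
DescentArc-valid x (j , (_ , xj<xi) , lo≡ , hi≡ , _) = subst₂ _<_ (sym lo≡) (sym hi≡) xj<xi

DescentArc-functional : ∀ {n} (x : Word n) {i α β} → DescentArc x i α → DescentArc x i β → α ≈a β
DescentArc-functional x (j , (adj , _) , lo≡ , hi≡ , lefts) (j′ , (adj′ , _) , lo≡′ , hi≡′ , lefts′)
  with adjacent-unique adj adj′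
... | refl = lo≡lo′ , hi≡hi′ , λ c lo<c c<hi →
               ⇔-trans (lefts c lo<c c<hi) (⇔-sym (lefts′ c (subst (_< c) lo≡lo′ lo<c) (subst (c <_) hi≡hi′ c<hi)))
  where
  lo≡lo′ = trans lo≡ (sym lo≡′)
  hi≡hi′ = trans hi≡ (sym hi≡′)

-- the order in which FrontFirst U lists the letters
FrontOrder : ∀ {n} → (Fin n → Bool) → Fin n → Fin n → Set
FrontOrder U c d = (U c ≡ true × U d ≡ false) ⊎ (U c ≡ U d × c < d)

FrontOrder-asym : ∀ {n} (U : Fin n → Bool) {c d} → FrontOrder U c d → ¬ FrontOrder U d c
FrontOrder-asym U (inj₁ (Uc , _)) (inj₁ (_ , Uc′)) = contradiction (trans (sym Uc) Uc′) λ ()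
FrontOrder-asym U (inj₁ (Uc , Ud)) (inj₂ (Ud≡Uc , _)) = contradiction (trans (sym Ud) (trans Ud≡Uc Uc)) λ ()
FrontOrder-asym U (inj₂ (Uc≡Ud , _)) (inj₁ (Ud , Uc)) = contradiction (trans (sym Uc) (trans Uc≡Ud Ud)) λ ()
FrontOrder-asym U (inj₂ (_ , c<d)) (inj₂ (_ , d<c)) = FP.<-asym c<d d<c

module SingleDescent {n : ℕ} {s : Word n} (ps : IsPerm s) {α : Arc n} (i j : Fin n)
                     (desc : Descent s i j) (unique : (i′ j′ : Fin n) → Descent s i′ j′ → i′ ≡ i)
                     (lo≡ : lo α ≡ lookup s j) (hi≡ : hi α ≡ lookup s i)
                     (lefts : LeftOfDescent s i α) where

  private
    pos = position s ps

    pos-hi : pos (hi α) ≡ i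
    pos-hi = position-unique s ps (sym hi≡)

    pos-lo : pos (lo α) ≡ j
    pos-lo = position-unique s ps (sym lo≡)

    letters : ∀ {c d} → lookup s (pos c) < lookup s (pos d) → c < d
    letters = subst₂ _<_ (lookup-position s ps _) (lookup-position s ps _)

  ascending : ∀ {p q} → p < q → q ≤ i ⊎ i < p → lookup s p < lookup s q
  ascending {p} {q} p<q side with lookup s p F.<? lookup s q
  ... | yes sp<sq = sp<sq
  ... | no sp≮sq with step-between (λ t → lookup s p F.≤? lookup s t) (ℕP.<⇒≤ p<q) FP.≤-refl
                        (λ sp≤sq → sp≮sq (FP.≤∧≢⇒< sp≤sq (λ eq → FP.<⇒≢ p<q (ps p q eq))))
  ...   | t , t′ , adj , p≤t , t′≤q , sp≤st , st′≮sp with unique t t′ (adj , ℕP.<-≤-trans (ℕP.≰⇒> st′≮sp) sp≤st)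
  ...     | refl with side
  ...       | inj₁ q≤i = ⊥-elim (ℕP.<-irrefl refl (ℕP.<-≤-trans (adjacent⇒< adj) (ℕP.≤-trans t′≤q q≤i)))
  ...       | inj₂ i<p = ⊥-elim (ℕP.<-irrefl refl (ℕP.<-≤-trans i<p p≤t))

  front⇒before-descent : ∀ {c} → front α c ≡ true → pos c ≤ i
  front⇒before-descent {c} fc with front-true α {c} fc
  ... | inj₂ (inj₂ refl) = ℕP.≤-reflexive (cong toℕ pos-hi)
  ... | inj₂ (inj₁ (lo<c , c<hi , lc)) with Equivalence.to (lefts c lo<c c<hi) lc
  ...   | k , k≤i , refl = subst (_≤ i) (sym (position-unique s ps refl)) k≤i
  front⇒before-descent {c} fc | inj₁ c<lo with pos c F.≤? i
  ... | yes p≤i = p≤i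
  ... | no p≰i = contradiction (subst₂ _<_ (sym lo≡) (lookup-position s ps c) (ascending j<p (inj₂ (adjacent⇒< (proj₁ desc)))))
                               (FP.<-asym c<lo)
    where
    j<p : j < pos c
    j<p = FP.≤∧≢⇒< (adjacent-gap (proj₁ desc) (ℕP.≰⇒> p≰i))
                   (λ j≡p → FP.<⇒≢ c<lo (trans (sym (lookup-position s ps c)) (trans (cong (lookup s) (sym j≡p)) (sym lo≡))))

  back⇒after-descent : ∀ {c} → front α c ≡ false → i < pos c
  back⇒after-descent {c} fc with front-false α {c} fc
  ... | inj₁ refl = subst (i <_) (sym pos-lo) (adjacent⇒< (proj₁ desc))
  ... | inj₂ (inj₁ (lo<c , c<hi , lc)) with i F.<? pos c
  ...   | yes i<p = i<p
  ...   | no i≮p = contradiction (trans (sym lc) (Equivalence.from (lefts c lo<c c<hi) (pos c , ℕP.≮⇒≥ i≮p , lookup-position s ps c))) λ ()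
  back⇒after-descent {c} fc | inj₂ (inj₂ hi<c) with i F.<? pos c
  ... | yes i<p = i<p
  ... | no i≮p = contradiction (subst₂ _<_ (lookup-position s ps c) (sym hi≡) (ascending p<i (inj₁ FP.≤-refl))) (FP.<-asym hi<c)
    where
    p<i : pos c < i
    p<i = FP.≤∧≢⇒< (ℕP.≮⇒≥ i≮p) (λ p≡i → FP.<⇒≢ hi<c (trans hi≡ (trans (cong (lookup s) (sym p≡i)) (lookup-position s ps c))))

  Precedes⇒FrontOrder : ∀ {c d} → Precedes s c d → FrontOrder (front α) c d
  Precedes⇒FrontOrder {c} {d} pre with front α c in fc | front α d in fd
  ... | true  | false = inj₁ (refl , refl)
  ... | false | true  = contradiction (FP.<-trans (back⇒after-descent fc) (Precedes⇒position s ps pre))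
                                      (ℕP.≤⇒≯ (front⇒before-descent fd))
  ... | true  | true  = inj₂ (refl , letters (ascending (Precedes⇒position s ps pre) (inj₁ (front⇒before-descent fd))))
  ... | false | false = inj₂ (refl , letters (ascending (Precedes⇒position s ps pre) (inj₂ (back⇒after-descent fc))))

FrontOrder-cong : ∀ {n} {U V : Fin n → Bool} → (∀ c → U c ≡ V c) → ∀ {c d} → FrontOrder U c d → FrontOrder V c d
FrontOrder-cong U≗V {c} {d} (inj₁ (Uc , Ud)) = inj₁ (trans (sym (U≗V c)) Uc , trans (sym (U≗V d)) Ud)
FrontOrder-cong U≗V {c} {d} (inj₂ (Uc≡Ud , c<d)) = inj₂ (trans (sym (U≗V c)) (trans Uc≡Ud (U≗V d)) , c<d)

ArcOf⇒FrontOrder : ∀ {n} (s : Word n) → IsPerm s → ∀ α → ArcOf s α → ∀ {c d} → Precedes s c d → FrontOrder (front α) c d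
ArcOf⇒FrontOrder s ps α (i , j , desc , unique , lo≡ , hi≡ , lefts) = SingleDescent.Precedes⇒FrontOrder {s = s} ps {α} i j desc unique lo≡ hi≡ lefts

ArcOf-injective : ∀ {n} (s s′ : Word n) → IsPerm s → IsPerm s′ → ∀ α β → ArcOf s α → ArcOf s′ β → α ≈a β → s ≡ s′
ArcOf-injective s s′ ps ps′ α β ao ao′ α≈β = Precedes-injective s s′ ps ps′ same
  where
  same : ∀ {c d} → Precedes s c d → Precedes s′ c d
  same {c} {d} pre with c F.≟ d
  ... | yes refl = contradiction pre (Precedes-irrefl s ps)
  ... | no c≢d with Precedes-total s′ ps′ c d c≢d
  ...   | inj₁ pre′ = pre′
  ...   | inj₂ pre′ = contradiction (ArcOf⇒FrontOrder s′ ps′ β ao′ pre′)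
                        (FrontOrder-asym (front β) (FrontOrder-cong (≈a-front α≈β) (ArcOf⇒FrontOrder s ps α ao pre)))

ArcOf-functional : ∀ {n} (s : Word n) → IsPerm s → ∀ α β → ArcOf s α → ArcOf s β → α ≈a β
ArcOf-functional s ps α β (i , j , desc , unique , lo≡ , hi≡ , lefts) (i′ , j′ , desc′ , _ , lo≡′ , hi≡′ , lefts′)
  with unique i′ j′ desc′
... | refl = DescentArc-functional s {α = α} {β} (j , desc , lo≡ , hi≡ , lefts) (j′ , desc′ , lo≡′ , hi≡′ , lefts′)

front-back-inside : ∀ {n} (α : Arc n) → ValidArc α → ∀ {a b} → front α a ≡ true → front α b ≡ false →
                    lo α ≤ b × a ≤ hi α
front-back-inside α lo<hi fa fb =
  ℕP.≮⇒≥ (λ b<lo → contradiction (trans (sym (front-below α b<lo)) fb) λ ()) ,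
  ℕP.≮⇒≥ (λ hi<a → contradiction (trans (sym (front-above α lo<hi hi<a)) fa) λ ())

-- The canonical join representation of a permutation

DescentArcs : ∀ {n} → Word n → List (Arc n) → Set
DescentArcs {n} x D = ((α : Arc n) → α ∈ D → Σ (Fin n) λ i → DescentArc x i α) ×
                      ((i j : Fin n) → Descent x i j → Σ (Arc n) λ α → α ∈ D × DescentArc x i α)

module _ {n : ℕ} (x : Word n) (px : IsPerm x) {i : Fin n} {α : Arc n} (da : DescentArc x i α) where

  private
    pos = position x px
    j = proj₁ da
    adj = proj₁ (proj₁ (proj₂ da))
    lo≡ = proj₁ (proj₂ (proj₂ da))
    hi≡ = proj₁ (proj₂ (proj₂ (proj₂ da)))
    lefts = proj₂ (proj₂ (proj₂ (proj₂ da)))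
    lo<hi = DescentArc-valid x {α = α} da

  DescentArc-front⁺ : ∀ {c} → lo α ≤ c → c ≤ hi α → pos c ≤ i → front α c ≡ true
  DescentArc-front⁺ {c} lo≤c c≤hi p≤i with c F.≟ hi α | lo α F.≟ c
  ... | yes refl | _ = front-hi α lo<hi
  ... | no _ | yes refl = contradiction (subst (ℕ._≤ toℕ i) (trans (cong toℕ (position-unique x px (sym lo≡))) adj) p≤i) ℕP.1+n≰n
  ... | no c≢hi | no lo≢c = trans (front-between α lo<c c<hi) (Equivalence.from (lefts c lo<c c<hi) (pos c , p≤i , lookup-position x px c))
    where
    lo<c = FP.≤∧≢⇒< lo≤c lo≢c
    c<hi = FP.≤∧≢⇒< c≤hi c≢hi

  DescentArc-front⁻ : ∀ {c} → lo α ≤ c → c ≤ hi α → front α c ≡ true → pos c ≤ i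
  DescentArc-front⁻ {c} lo≤c c≤hi fc with front-true α {c} fc
  ... | inj₁ c<lo = contradiction lo≤c (ℕP.<⇒≱ c<lo)
  ... | inj₂ (inj₂ refl) = ℕP.≤-reflexive (cong toℕ (position-unique x px (sym hi≡)))
  ... | inj₂ (inj₁ (lo<c , c<hi , lc)) with Equivalence.to (lefts c lo<c c<hi) lc
  ...   | k , k≤i , refl = subst (_≤ i) (sym (position-unique x px refl)) k≤i

  DescentArc-after : ∀ {c} → lo α ≤ c → c ≤ hi α → i < pos c → front α c ≡ false
  DescentArc-after {c} lo≤c c≤hi i<p with front α c in fc
  ... | false = refl
  ... | true  = contradiction (DescentArc-front⁻ lo≤c c≤hi fc) (ℕP.<⇒≱ i<p)

  DescentArc-back : ∀ {c} → lo α ≤ c → c ≤ hi α → front α c ≡ false → i < pos c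
  DescentArc-back lo≤c c≤hi fc = ℕP.≰⇒> (λ p≤i → contradiction (trans (sym fc) (DescentArc-front⁺ lo≤c c≤hi p≤i)) λ ())

  DescentArc-Precedes : ∀ {a b} → front α a ≡ true → front α b ≡ false → b < a → Precedes x a b
  DescentArc-Precedes fa fb b<a with front-back-inside α lo<hi fa fb
  ... | lo≤b , a≤hi = position⇒Precedes x px
      (ℕP.≤-<-trans (DescentArc-front⁻ (ℕP.<⇒≤ (ℕP.≤-<-trans lo≤b b<a)) a≤hi fa)
                    (DescentArc-back lo≤b (ℕP.<⇒≤ (ℕP.<-≤-trans b<a a≤hi)) fb))

  joinIrreducible≤w : joinIrreducible α ≤w x
  joinIrreducible≤w a b inv with Inv-joinIrreducible⁻ α inv
  ... | fa , fb = Precedes⇒Inv x (DescentArc-Precedes fa fb (Inv⇒> (joinIrreducible α) inv)) (Inv⇒> (joinIrreducible α) inv)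

module AdjacentSwap {n : ℕ} (x : Word n) (px : IsPerm x) (i j : Fin n) (adj : Adjacent i j) where

  τ : Fin n → Fin n
  τ k with k F.≟ i | k F.≟ j
  ... | yes _ | _     = j
  ... | no _  | yes _ = i
  ... | no _  | no _  = k

  private
    i<j = adjacent⇒< adj

  τ-i : τ i ≡ j
  τ-i with i F.≟ i
  ... | yes _ = refl
  ... | no i≢i = contradiction refl i≢i

  τ-j : τ j ≡ i
  τ-j with j F.≟ i | j F.≟ j
  ... | yes j≡i | _ = contradiction (sym j≡i) (FP.<⇒≢ i<j)
  ... | no _ | yes _ = refl
  ... | no _ | no j≢j = contradiction refl j≢j

  τ-other : ∀ {k} → k ≢ i → k ≢ j → τ k ≡ k
  τ-other {k} k≢i k≢j with k F.≟ i | k F.≟ j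
  ... | yes k≡i | _ = contradiction k≡i k≢i
  ... | no _ | yes k≡j = contradiction k≡j k≢j
  ... | no _ | no _ = refl

  τ-involutive : ∀ k → τ (τ k) ≡ k
  τ-involutive k = cases (k F.≟ i) (k F.≟ j)
    where
    cases : Dec (k ≡ i) → Dec (k ≡ j) → τ (τ k) ≡ k
    cases (yes refl) _ = trans (cong τ τ-i) τ-j
    cases (no _) (yes refl) = trans (cong τ τ-j) τ-i
    cases (no k≢i) (no k≢j) = trans (cong τ (τ-other k≢i k≢j)) (τ-other k≢i k≢j)

  τ-mono : ∀ {k m} → k < m → ¬ (k ≡ i × m ≡ j) → τ k < τ m
  τ-mono {k} {m} k<m not-ij = cases (k F.≟ i) (k F.≟ j) (m F.≟ i) (m F.≟ j)
    where
    cases : Dec (k ≡ i) → Dec (k ≡ j) → Dec (m ≡ i) → Dec (m ≡ j) → τ k < τ m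
    cases (yes refl) _ _ (yes refl) = contradiction (refl , refl) not-ij
    cases (yes refl) _ (yes refl) _ = contradiction k<m (FP.<-irrefl refl)
    cases (yes refl) _ (no m≢i) (no m≢j) =
      subst₂ _<_ (sym τ-i) (sym (τ-other m≢i m≢j)) (FP.≤∧≢⇒< (adjacent-gap adj k<m) (m≢j ∘ sym))
    cases (no _) (yes refl) (yes refl) _ = contradiction k<m (FP.<-asym i<j)
    cases (no _) (yes refl) (no _) (yes refl) = contradiction k<m (FP.<-irrefl refl)
    cases (no _) (yes refl) (no m≢i) (no m≢j) = subst₂ _<_ (sym τ-j) (sym (τ-other m≢i m≢j)) (FP.<-trans i<j k<m)
    cases (no k≢i) (no k≢j) (yes refl) _ = subst₂ _<_ (sym (τ-other k≢i k≢j)) (sym τ-i) (FP.<-trans k<m i<j)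
    cases (no k≢i) (no k≢j) (no _) (yes refl) =
      subst₂ _<_ (sym (τ-other k≢i k≢j)) (sym τ-j)
             (FP.≤∧≢⇒< (ℕP.≮⇒≥ (λ i<k → ℕP.<-irrefl refl (ℕP.<-≤-trans k<m (adjacent-gap adj i<k)))) k≢i)
    cases (no k≢i) (no k≢j) (no m≢i) (no m≢j) = subst₂ _<_ (sym (τ-other k≢i k≢j)) (sym (τ-other m≢i m≢j)) k<m

  swapped : Word n
  swapped = tabulate (lookup x ∘ τ)

  lookup-swapped : ∀ k → lookup swapped (τ k) ≡ lookup x k
  lookup-swapped k = trans (VP.lookup∘tabulate (lookup x ∘ τ) (τ k)) (cong (lookup x) (τ-involutive k))

  swapped-perm : IsPerm swapped
  swapped-perm k m eq = trans (sym (τ-involutive k)) (trans (cong τ (px _ _ xτk≡xτm)) (τ-involutive m))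
    where
    xτk≡xτm = trans (sym (VP.lookup∘tabulate (lookup x ∘ τ) k)) (trans eq (VP.lookup∘tabulate (lookup x ∘ τ) m))

  swapped-Precedes : ∀ {a b} → Precedes x a b → ¬ (a ≡ lookup x i × b ≡ lookup x j) → Precedes swapped a b
  swapped-Precedes (k , m , k<m , refl , refl) not-ij =
    τ k , τ m , τ-mono k<m (λ { (refl , refl) → not-ij (refl , refl) }) , lookup-swapped k , lookup-swapped m

  swapped-descent : Precedes swapped (lookup x j) (lookup x i)
  swapped-descent = τ j , τ i , subst₂ _<_ (sym τ-j) (sym τ-i) i<j , lookup-swapped j , lookup-swapped i

Inv? : ∀ {n} (x : Word n) a b → Dec (Inv x a b)
Inv? x a b = FP.any? λ k → FP.any? λ m →
  (k F.<? m) ×-dec (lookup x k F.≟ a) ×-dec (lookup x m F.≟ b) ×-dec (b F.<? a)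

_≤w?_ : ∀ {n} (x y : Word n) → Dec (x ≤w y)
x ≤w? y = FP.all? λ a → FP.all? λ b → Inv? x a b →-dec Inv? y a b

module _ {n : ℕ} (x : Word n) (px : IsPerm x) where

  DescentArc-at : ∀ {i′ β i j} → DescentArc x i′ β → Descent x i j →
                  front β (lookup x i) ≡ true → front β (lookup x j) ≡ false → i′ ≡ i
  DescentArc-at {i′} {β} {i} {j} da (adj , xj<xi) fi fj with front-back-inside β (DescentArc-valid x {α = β} da) fi fj
  ... | lo≤xj , xi≤hi = FP.toℕ-injective (ℕP.≤-antisym
        (ℕP.≤-pred (subst (toℕ i′ ℕ.<_) (trans (cong toℕ (position-unique x px refl)) adj)
                       (DescentArc-back x px da lo≤xj (ℕP.<⇒≤ (ℕP.<-≤-trans xj<xi xi≤hi)) fj)))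
        (subst (ℕ._≤ toℕ i′) (cong toℕ (position-unique x px refl))
               (DescentArc-front⁻ x px da (ℕP.<⇒≤ (ℕP.≤-<-trans lo≤xj xj<xi)) xi≤hi fi)))

  swapped-not-above : ∀ {i j} (desc : Descent x i j) → ¬ x ≤w AdjacentSwap.swapped x px i j (proj₁ desc)
  swapped-not-above {i} {j} (adj , xj<xi) x≤y =
    Precedes-asym swapped swapped-perm swapped-descent
      (Inv⇒Precedes swapped (x≤y _ _ (i , j , adjacent⇒< adj , refl , refl , xj<xi)))
    where open AdjacentSwap x px i j adj

module CanonicalJoin {n : ℕ} (x : Word n) (px : IsPerm x) (D : List (Arc n)) (arcs : DescentArcs x D) where

  S : List (Word n)
  S = L.map joinIrreducible D

  ∈S⁻ : ∀ {s} → s ∈ S → ∃ λ α → α ∈ D × s ≡ joinIrreducible α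
  ∈S⁻ = ∈P.∈-map⁻ joinIrreducible

  S-perm : ∀ s → s ∈ S → IsPerm s
  S-perm s s∈S with ∈S⁻ s∈S
  ... | α , _ , refl = joinIrreducible-perm α

  S-below : ∀ s → s ∈ S → s ≤w x
  S-below s s∈S with ∈S⁻ s∈S
  ... | α , α∈D , refl = joinIrreducible≤w x px (proj₂ (proj₁ arcs α α∈D))

  module Least (y : Word n) (py : IsPerm y) (above : ∀ t → t ∈ S → t ≤w y) where

    private
      pos = position x px

    separated : ∀ {i α a b} → α ∈ D → DescentArc x i α → b < a → lo α ≤ b → a ≤ hi α → pos a ≤ i → i < pos b →
                Precedes y a b
    separated {α = α} α∈D da b<a lo≤b a≤hi pa≤i i<pb =
      Inv⇒Precedes y (above _ (∈P.∈-map⁺ joinIrreducible α∈D) _ _ (Inv-joinIrreducible⁺ α b<a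
        (DescentArc-front⁺ x px da (ℕP.<⇒≤ (ℕP.≤-<-trans lo≤b b<a)) a≤hi pa≤i)
        (DescentArc-after x px da lo≤b (ℕP.<⇒≤ (ℕP.<-≤-trans b<a a≤hi)) i<pb)))

    -- an inversion of x with no letter between it in value and position is separated by a single descent arc
    covered : ∀ {k m} → k < m → lookup x m < lookup x k →
              (∀ q → k < q → q < m → lookup x m < lookup x q → ¬ lookup x q < lookup x k) →
              Precedes y (lookup x k) (lookup x m)
    covered {k} {m} k<m xm<xk nothing-between
      with step-between (λ t → lookup x k F.≤? lookup x t) (ℕP.<⇒≤ k<m) FP.≤-refl (ℕP.<⇒≱ xm<xk)
    ... | t , t′ , adj , k≤t , t′≤m , xk≤xt , xk≰xt′
      with proj₂ arcs t t′ (adj , ℕP.<-≤-trans (ℕP.≰⇒> xk≰xt′) xk≤xt)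
    ...   | α , α∈D , da@(_ , (adj′ , _) , lo≡ , hi≡ , _) with adjacent-unique adj adj′
    ...     | refl = separated α∈D da xm<xk (subst (_≤ lookup x m) (sym lo≡) xt′≤xm) (subst (lookup x k ≤_) (sym hi≡) xk≤xt)
                       (subst (_≤ t) (sym (position-unique x px refl)) k≤t)
                       (subst (t <_) (sym (position-unique x px refl)) (ℕP.<-≤-trans (adjacent⇒< adj) t′≤m))
      where
      xt′≤xm : lookup x t′ ≤ lookup x m
      xt′≤xm with t′ F.≟ m
      ... | yes refl = ℕP.≤-refl
      ... | no t′≢m = ℕP.≮⇒≥ λ xm<xt′ → nothing-between t′ (ℕP.≤-<-trans k≤t (adjacent⇒< adj)) (FP.≤∧≢⇒< t′≤m t′≢m)
                                                          xm<xt′ (ℕP.≰⇒> xk≰xt′)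

    -- general inversions split at a letter between them, by induction on their distance
    inversion-above : ∀ g {k m} → toℕ m ∸ toℕ k ≡ g → k < m → lookup x m < lookup x k →
                      Precedes y (lookup x k) (lookup x m)
    inversion-above = <-rec _ λ g rec {k} {m} gap k<m xm<xk →
      case FP.any? (λ q → (k F.<? q) ×-dec (q F.<? m) ×-dec (lookup x m F.<? lookup x q) ×-dec (lookup x q F.<? lookup x k)) of λ where
        (yes (q , k<q , q<m , xm<xq , xq<xk)) →
          Precedes-trans y py
            (rec (subst (toℕ q ∸ toℕ k ℕ.<_) gap (ℕP.∸-monoˡ-< q<m (ℕP.<⇒≤ k<q))) refl k<q xq<xk)
            (rec (subst (toℕ m ∸ toℕ q ℕ.<_) gap (ℕP.∸-monoʳ-< k<q (ℕP.<⇒≤ q<m))) refl q<m xm<xq)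
        (no none) → covered k<m xm<xk λ q k<q q<m xm<xq xq<xk → none (q , k<q , q<m , xm<xq , xq<xk)

    x≤w : x ≤w y
    x≤w a b (k , m , k<m , refl , refl , b<a) = Precedes⇒Inv y (inversion-above _ refl k<m b<a) b<a

  isJoin : IsJoin S x
  isJoin = S-below , λ y py above → Least.x≤w y py above

  -- undoing the descent of α ∈ D gives an upper bound of the other join-irreducibles that is not above x
  module UndoDescent {i : Fin n} {α : Arc n} (α∈D : α ∈ D) (da : DescentArc x i α) where

    private
      j = proj₁ da
      desc = proj₁ (proj₂ da)
      adj = proj₁ desc
      lo≡ = proj₁ (proj₂ (proj₂ da))
      hi≡ = proj₁ (proj₂ (proj₂ (proj₂ da)))
      pos = position x px
    open AdjacentSwap x px i j adj public

    below-swapped : ∀ {β} → β ∈ D → joinIrreducible β ≢ joinIrreducible α → joinIrreducible β ≤w swapped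
    below-swapped {β} β∈D Jβ≢Jα a b inv with proj₁ arcs β β∈D | Inv-joinIrreducible⁻ β inv
    ... | i′ , db | fa , fb = Precedes⇒Inv swapped (swapped-Precedes (DescentArc-Precedes x px db fa fb b<a) same-descent) b<a
      where
      b<a = Inv⇒> (joinIrreducible β) inv
      same-descent : ¬ (a ≡ lookup x i × b ≡ lookup x j)
      same-descent (refl , refl) with DescentArc-at x px db desc fa fb
      ... | refl = Jβ≢Jα (ArcOf-injective _ _ (joinIrreducible-perm β) (joinIrreducible-perm α) β α
                           (joinIrreducible-ArcOf β (DescentArc-valid x {α = β} db))
                           (joinIrreducible-ArcOf α (DescentArc-valid x {α = α} da))
                           (DescentArc-functional x {α = β} {α} db da))

    not-join-without : ∀ S′ → S′ ⊆ S → joinIrreducible α ∉ S′ → ¬ IsJoin S′ x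
    not-join-without S′ S′⊆S Jα∉S′ (_ , least′) = swapped-not-above x px desc (least′ swapped swapped-perm others-below)
      where
      others-below : ∀ t → t ∈ S′ → t ≤w swapped
      others-below t t∈S′ with ∈S⁻ (S′⊆S t∈S′)
      ... | β , β∈D , refl = below-swapped β∈D λ Jβ≡Jα → Jα∉S′ (subst (_∈ S′) Jβ≡Jα t∈S′)

    module _ (t : Word n) (pt : IsPerm t) (t≤x : t ≤w x) where

      swap-keeps : ∀ {a b} → Inv t a b → ¬ (a ≡ lookup x i × b ≡ lookup x j) → Inv swapped a b
      swap-keeps inv not-ij = Precedes⇒Inv swapped (swapped-Precedes (Inv⇒Precedes x (t≤x _ _ inv)) not-ij) (Inv⇒> t inv)

      descent-kept : ¬ t ≤w swapped → Precedes t (lookup x i) (lookup x j)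
      descent-kept t≰y with FP.¬∀⟶∃¬ n _ (λ a → FP.all? λ b → Inv? t a b →-dec Inv? swapped a b) t≰y
      ... | a , ¬∀b with FP.¬∀⟶∃¬ n _ (λ b → Inv? t a b →-dec Inv? swapped a b) ¬∀b
      ...   | b , ¬inherited with Inv? t a b | a F.≟ lookup x i | b F.≟ lookup x j
      ...     | no ¬inv | _ | _ = contradiction (λ inv → contradiction inv ¬inv) ¬inherited
      ...     | yes inv | yes refl | yes refl = Inv⇒Precedes t inv
      ...     | yes inv | no a≢xi | _ = contradiction (λ _ → swap-keeps inv (a≢xi ∘ proj₁)) ¬inherited
      ...     | yes inv | yes _ | no b≢xj = contradiction (λ _ → swap-keeps inv (b≢xj ∘ proj₂)) ¬inherited

      -- t lists hi before lo; it inherits from x that the other letters in front of α precede hi and the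
      -- other letters behind follow lo, as those pairs are not inversions
      joinIrreducible≤w-keeping : Precedes t (lookup x i) (lookup x j) → joinIrreducible α ≤w t
      joinIrreducible≤w-keeping hi-before-lo a b inv with Inv-joinIrreducible⁻ α inv
      ... | fa , fb with front-back-inside α (DescentArc-valid x {α = α} da) fa fb
      ...   | lo≤b , a≤hi = Precedes⇒Inv t (chain to-hi from-lo) b<a
        where
        b<a = Inv⇒> (joinIrreducible α) inv
        inherit : ∀ {c d} → c < d → Precedes x c d → Precedes t c d
        inherit = ≤w⇒Precedes t x pt px t≤x
        pa≤i : pos a ≤ i
        pa≤i = DescentArc-front⁻ x px da (ℕP.<⇒≤ (ℕP.≤-<-trans lo≤b b<a)) a≤hi fa
        i<pb : i < pos b
        i<pb = DescentArc-back x px da lo≤b (ℕP.<⇒≤ (ℕP.<-≤-trans b<a a≤hi)) fb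
        to-hi : a ≡ lookup x i ⊎ Precedes t a (lookup x i)
        to-hi with pos a F.≟ i
        ... | yes refl = inj₁ (sym (lookup-position x px a))
        ... | no pa≢i = inj₂ (inherit a<hi (pos a , i , FP.≤∧≢⇒< pa≤i pa≢i , lookup-position x px a , refl))
          where
          a<hi : a < lookup x i
          a<hi = FP.≤∧≢⇒< (subst (a ≤_) hi≡ a≤hi) (λ a≡xi → pa≢i (position-unique x px (sym a≡xi)))
        from-lo : b ≡ lookup x j ⊎ Precedes t (lookup x j) b
        from-lo with pos b F.≟ j
        ... | yes refl = inj₁ (sym (lookup-position x px b))
        ... | no pb≢j = inj₂ (inherit lo<b (j , pos b , FP.≤∧≢⇒< (adjacent-gap adj i<pb) (pb≢j ∘ sym) , refl , lookup-position x px b))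
          where
          lo<b : lookup x j < b
          lo<b = FP.≤∧≢⇒< (subst (_≤ b) lo≡ lo≤b) (λ xj≡b → pb≢j (position-unique x px xj≡b))
        chain : a ≡ lookup x i ⊎ Precedes t a (lookup x i) → b ≡ lookup x j ⊎ Precedes t (lookup x j) b → Precedes t a b
        chain (inj₁ refl) (inj₁ refl) = hi-before-lo
        chain (inj₁ refl) (inj₂ lo-b) = Precedes-trans t pt hi-before-lo lo-b
        chain (inj₂ a-hi) (inj₁ refl) = Precedes-trans t pt a-hi hi-before-lo
        chain (inj₂ a-hi) (inj₂ lo-b) = Precedes-trans t pt (Precedes-trans t pt a-hi hi-before-lo) lo-b

    refined : (T : List (Word n)) → (∀ t → t ∈ T → IsPerm t) → IsJoin T x →
              Σ (Word n) λ t → t ∈ T × joinIrreducible α ≤w t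
    refined T T-perm (T-below , T-least)
      with counterexample (_≤w? swapped) T (swapped-not-above x px desc ∘ T-least swapped swapped-perm ∘ λ all t → all {t})
    ... | t , t∈T , t≰y = t , t∈T , joinIrreducible≤w-keeping t pt t≤x (descent-kept t pt t≤x t≰y)
      where
      pt = T-perm t t∈T
      t≤x = T-below t t∈T

  irredundant : (S′ : List (Word n)) → S′ ⊆ S → ¬ (S ⊆ S′) → ¬ IsJoin S′ x
  irredundant S′ S′⊆S S⊈S′ with counterexample (λ s → DecMembership._∈?_ (VP.≡-dec FP._≟_) s S′) S S⊈S′
  ... | s , s∈S , s∉S′ with ∈S⁻ s∈S
  ...   | α , α∈D , refl = UndoDescent.not-join-without α∈D (proj₂ (proj₁ arcs α α∈D)) S′ S′⊆S s∉S′

  refines : (T : List (Word n)) → (∀ t → t ∈ T → IsPerm t) → IsJoin T x →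
            ∀ s → s ∈ S → Σ (Word n) λ t → t ∈ T × s ≤w t
  refines T T-perm T-join s s∈S with ∈S⁻ s∈S
  ... | α , α∈D , refl = UndoDescent.refined α∈D (proj₂ (proj₁ arcs α α∈D)) T T-perm T-join

  delta : Delta x D
  delta = S , (S-perm , isJoin , irredundant , refines) ,
          (λ α α∈D → joinIrreducible α , ∈P.∈-map⁺ joinIrreducible α∈D , arcOf α∈D) ,
          λ s s∈S → case ∈S⁻ s∈S of λ { (α , α∈D , refl) → α , α∈D , arcOf α∈D }
    where
    arcOf : ∀ {α} → α ∈ D → ArcOf (joinIrreducible α) α
    arcOf {α} α∈D = joinIrreducible-ArcOf α (DescentArc-valid x {α = α} (proj₂ (proj₁ arcs α α∈D)))

-- Uniqueness of canonical join representations, and injectivity of δ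

module _ {n : ℕ} (x : Word n) where

  -- dropping an element below another one keeps the join, so irredundance makes S an antichain
  canonical-antichain : ∀ {S} → IsCanonicalJoinRep x S → ∀ {s s′} → s ∈ S → s′ ∈ S → s ≢ s′ → ¬ s ≤w s′
  canonical-antichain {S} (_ , (S-below , S-least) , irredundant , _) {s} {s′} s∈S s′∈S s≢s′ s≤s′ =
    irredundant S∖s (λ t∈ → proj₁ (∈-S∖s⁻ t∈)) (λ S⊆S∖s → proj₂ (∈-S∖s⁻ (S⊆S∖s s∈S)) refl)
                ((λ t t∈ → S-below t (proj₁ (∈-S∖s⁻ t∈))) , λ y py above → S-least y py (above-all y above))
    where
    ≢s? = λ t → ¬? (VP.≡-dec FP._≟_ t s)
    S∖s = L.filter ≢s? S
    ∈-S∖s⁻ : ∀ {t} → t ∈ S∖s → t ∈ S × t ≢ s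
    ∈-S∖s⁻ = ∈P.∈-filter⁻ ≢s? {xs = S}
    above-all : ∀ y → (∀ t → t ∈ S∖s → t ≤w y) → ∀ t → t ∈ S → t ≤w y
    above-all y above t t∈S with VP.≡-dec FP._≟_ t s
    ... | yes refl = ≤w-trans {x = s} {s′} {y} s≤s′ (above s′ (∈P.∈-filter⁺ ≢s? s′∈S (s≢s′ ∘ sym)))
    ... | no t≢s = above t (∈P.∈-filter⁺ ≢s? t∈S t≢s)

  -- each element of one canonical join representation is refined by the other, and both are antichains
  canonical-⊆ : ∀ {S S′} → IsCanonicalJoinRep x S → IsCanonicalJoinRep x S′ → S′ ⊆ S
  canonical-⊆ {S} {S′} C@(S-perm , S-join , _ , S-refines) C′@(S′-perm , S′-join , _ , S′-refines) {s′} s′∈S′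
    with S′-refines S S-perm S-join s′ s′∈S′
  ... | s , s∈S , s′≤s with S-refines S′ S′-perm S′-join s s∈S
  ...   | s″ , s″∈S′ , s≤s″ with VP.≡-dec FP._≟_ s′ s″
  ...     | yes refl = subst (_∈ S) (≤w-antisym s s′ (S-perm s s∈S) (S′-perm s′ s′∈S′) s≤s″ s′≤s) s∈S
  ...     | no s′≢s″ = contradiction (≤w-trans {x = s′} {s} {s″} s′≤s s≤s″) (canonical-antichain C′ s′∈S′ s″∈S′ s′≢s″)

Delta-unique : ∀ {n} (x : Word n) (D D′ : List (Arc n)) → Delta x D → Delta x D′ → D′ ≈D D
Delta-unique x D D′ (S , C , D→S , S→D) (S′ , C′ , D′→S′ , S′→D′) = one-way , other-way
  where
  one-way : ∀ α → α ∈ D′ → Σ (Arc _) λ β → β ∈ D × α ≈a β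
  one-way α α∈D′ with D′→S′ α α∈D′
  ... | s′ , s′∈S′ , s′-α with S→D s′ (canonical-⊆ x C C′ s′∈S′)
  ...   | β , β∈D , s′-β = β , β∈D , ArcOf-functional s′ (proj₁ C′ s′ s′∈S′) α β s′-α s′-β
  other-way : ∀ β → β ∈ D → Σ (Arc _) λ α → α ∈ D′ × α ≈a β
  other-way β β∈D with D→S β β∈D
  ... | s , s∈S , s-β with S′→D′ s (canonical-⊆ x C′ C s∈S)
  ...   | α , α∈D′ , s-α = α , α∈D′ , ArcOf-functional s (proj₁ C s s∈S) α β s-α s-β

≈a-sym : ∀ {n} {α β : Arc n} → α ≈a β → β ≈a α
≈a-sym (refl-lo , refl-hi , lefts) = sym refl-lo , sym refl-hi , λ c lo<c c<hi →
  ⇔-sym (lefts c (subst (_< c) (sym refl-lo) lo<c) (subst (c <_) (sym refl-hi) c<hi))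

-- every join-irreducible of x reappears among those of y, so x = ⋁ S ≤ y
Delta-≤w : ∀ {n} (x y : Word n) (D E : List (Arc n)) → IsPerm y → Delta x D → Delta y E →
           (∀ α → α ∈ D → Σ (Arc n) λ β → β ∈ E × α ≈a β) → x ≤w y
Delta-≤w x y D E py (S , (S-perm , (_ , S-least) , _) , _ , S→D) (T , (T-perm , (T-below , _) , _) , E→T , _) D→E =
  S-least y py above
  where
  above : ∀ s → s ∈ S → s ≤w y
  above s s∈S with S→D s s∈S
  ... | α , α∈D , s-α with D→E α α∈D
  ...   | β , β∈E , α≈β with E→T β β∈E
  ...     | t , t∈T , t-β = subst (_≤w y) (sym (ArcOf-injective s t (S-perm s s∈S) (T-perm t t∈T) α β s-α t-β α≈β)) (T-below t t∈T)

Delta-injective : ∀ {n} (x y : Word n) (D E : List (Arc n)) → IsPerm x → IsPerm y →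
                  Delta x D → Delta y E → D ≈D E → x ≡ y
Delta-injective x y D E px py δx δy (D→E , E→D) =
  ≤w-antisym x y px py (Delta-≤w x y D E py δx δy D→E) (Delta-≤w y x E D px δy δx E→D′)
  where
  E→D′ : ∀ β → β ∈ E → Σ (Arc _) λ α → α ∈ D × β ≈a α
  E→D′ β β∈E with E→D β β∈E
  ... | α , α∈D , α≈β = α , α∈D , ≈a-sym {α = α} {β} α≈β

Compatible : ∀ {n} → Arc n → Arc n → Set
Compatible α β = lo α ≢ lo β × hi α ≢ hi β × ¬ Cross α β × ¬ Cross β α

AllPairs-noncrossing : ∀ {n} {D : List (Arc n)} → (∀ α → α ∈ D → ValidArc α) → AllPairs Compatible D →
                       IsNoncrossingDiagram D
AllPairs-noncrossing {D = D} valid compatible = valid , λ p q p≢q → orient {L.lookup D p} {L.lookup D q} (AllPairs-lookup compatible p≢q)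
  where
  orient : ∀ {α β} → Compatible α β ⊎ Compatible β α → lo α ≢ lo β × hi α ≢ hi β × ¬ Cross α β
  orient (inj₁ (lo≢ , hi≢ , ¬αβ , _)) = lo≢ , hi≢ , ¬αβ
  orient (inj₂ (lo≢ , hi≢ , _ , ¬αβ)) = lo≢ ∘ sym , hi≢ ∘ sym , ¬αβ

-- The noncrossing diagram of descent arcs of a permutation

module _ {n : ℕ} (α : Arc n) where

  posAt-lo : posAt α (lo α) ≡ 1
  posAt-lo rewrite dec-true (lo α F.≟ lo α) refl = refl

  posAt-hi : ValidArc α → posAt α (hi α) ≡ 1
  posAt-hi lo<hi rewrite dec-false (hi α F.≟ lo α) (FP.<⇒≢ lo<hi ∘ sym) | dec-true (hi α F.≟ hi α) refl = refl

  posAt-between : ∀ {c} → lo α < c → c < hi α → posAt α c ≡ (if lookup (left α) c then 2 else 0)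
  posAt-between {c} lo<c c<hi rewrite dec-false (c F.≟ lo α) (FP.<⇒≢ lo<c ∘ sym) | dec-false (c F.≟ hi α) (FP.<⇒≢ c<hi) = refl

posAt-left : ∀ {n} (α : Arc n) {c} → lo α < c → c < hi α → lookup (left α) c ≡ true → posAt α c ≡ 2
posAt-left α lo<c c<hi lc = trans (posAt-between α lo<c c<hi) (cong (λ b → if b then 2 else 0) lc)

posAt-right : ∀ {n} (α : Arc n) {c} → lo α < c → c < hi α → lookup (left α) c ≡ false → posAt α c ≡ 0
posAt-right α lo<c c<hi lc = trans (posAt-between α lo<c c<hi) (cong (λ b → if b then 2 else 0) lc)

-- posAt of the arc of the descent at i, at the letter in position k
profile : ℕ → ℕ → ℕ
profile i k with k ℕ.<? i | k ℕ.≤? suc i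
... | yes _ | _     = 2
... | no _  | yes _ = 1
... | no _  | no _  = 0

profile-mono : ∀ {i i′} k → i ℕ.< i′ → profile i k ℕ.≤ profile i′ k
profile-mono {i} {i′} k i<i′ with k ℕ.<? i | k ℕ.≤? suc i | k ℕ.<? i′ | k ℕ.≤? suc i′
... | yes _ | _ | yes _ | _ = ℕP.≤-refl
... | yes k<i | _ | no k≮i′ | _ = contradiction (ℕP.<-trans k<i i<i′) k≮i′
... | no _ | no _ | _ | _ = z≤n
... | no _ | yes _ | yes _ | _ = s≤s z≤n
... | no _ | yes _ | no _ | yes _ = ℕP.≤-refl
... | no _ | yes k≤1+i | no _ | no k≰1+i′ = contradiction (ℕP.≤-trans k≤1+i (s≤s (ℕP.<⇒≤ i<i′))) k≰1+i′

profile-before : ∀ {i k} → k ℕ.< i → profile i k ≡ 2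
profile-before {i} {k} k<i with k ℕ.<? i
... | yes _ = refl
... | no k≮i = contradiction k<i k≮i

profile-at : ∀ {i k} → i ℕ.≤ k → k ℕ.≤ suc i → profile i k ≡ 1
profile-at {i} {k} i≤k k≤1+i with k ℕ.<? i | k ℕ.≤? suc i
... | yes k<i | _ = contradiction i≤k (ℕP.<⇒≱ k<i)
... | no _ | yes _ = refl
... | no _ | no k≰1+i = contradiction k≤1+i k≰1+i

profile-after : ∀ {i k} → suc i ℕ.< k → profile i k ≡ 0
profile-after {i} {k} 1+i<k with k ℕ.<? i | k ℕ.≤? suc i
... | yes k<i | _ = contradiction (ℕP.<-trans k<i (ℕP.<-trans (ℕP.n<1+n i) 1+i<k)) (ℕP.<-irrefl refl)
... | no _ | yes k≤1+i = contradiction k≤1+i (ℕP.<⇒≱ 1+i<k)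
... | no _ | no _ = refl

module _ {n : ℕ} (x : Word n) (px : IsPerm x) where

  private
    pos = position x px

  DescentArc-posAt : ∀ {i α c} → DescentArc x i α → lo α ≤ c → c ≤ hi α → posAt α c ≡ profile (toℕ i) (toℕ (pos c))
  DescentArc-posAt {i} {α} {c} da@(j , (adj , _) , lo≡ , hi≡ , _) lo≤c c≤hi = cases (c F.≟ lo α) (c F.≟ hi α)
    where
    pos-lo : toℕ (pos (lo α)) ≡ suc (toℕ i)
    pos-lo = trans (cong toℕ (position-unique x px (sym lo≡))) adj
    pos-hi : toℕ (pos (hi α)) ≡ toℕ i
    pos-hi = cong toℕ (position-unique x px (sym hi≡))
    between : lo α < c → c < hi α → ∀ b → front α c ≡ b → posAt α c ≡ profile (toℕ i) (toℕ (pos c))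
    between lo<c c<hi b fc rewrite posAt-between α lo<c c<hi | sym (front-between α lo<c c<hi) | fc with b
    ... | true  = sym (profile-before (ℕP.≤∧≢⇒< (DescentArc-front⁻ x px da lo≤c c≤hi fc)
                                                (FP.<⇒≢ c<hi ∘ position-injective x px ∘ λ p≡i → trans p≡i (sym pos-hi))))
    ... | false = sym (profile-after (ℕP.≤∧≢⇒< (DescentArc-back x px da lo≤c c≤hi fc)
                                               (FP.<⇒≢ lo<c ∘ sym ∘ position-injective x px ∘ λ 1+i≡p → trans (sym 1+i≡p) (sym pos-lo) )))
    cases : Dec (c ≡ lo α) → Dec (c ≡ hi α) → posAt α c ≡ profile (toℕ i) (toℕ (pos c))
    cases (yes refl) _ = trans (posAt-lo α) (sym (profile-at (ℕP.≤-trans (ℕP.n≤1+n _) (ℕP.≤-reflexive (sym pos-lo))) (ℕP.≤-reflexive pos-lo)))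
    cases (no _) (yes refl) = trans (posAt-hi α (DescentArc-valid x {α = α} da))
                                    (sym (profile-at (ℕP.≤-reflexive (sym pos-hi)) (ℕP.≤-trans (ℕP.≤-reflexive pos-hi) (ℕP.n≤1+n _))))
    cases (no c≢lo) (no c≢hi) = between (FP.≤∧≢⇒< lo≤c (c≢lo ∘ sym)) (FP.≤∧≢⇒< c≤hi c≢hi) (front α c) refl

  DescentArc-dominated : ∀ {i i′ α β} → DescentArc x i α → DescentArc x i′ β → i < i′ →
                         ∀ {c} → InBoth α β c → posAt α c ℕ.≤ posAt β c
  DescentArc-dominated {α = α} {β} da db i<i′ (lo≤c , c≤hi , lo′≤c , c≤hi′) =
    subst₂ ℕ._≤_ (sym (DescentArc-posAt {α = α} da lo≤c c≤hi)) (sym (DescentArc-posAt {α = β} db lo′≤c c≤hi′)) (profile-mono _ i<i′)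

  DescentArc-uncrossed : ∀ {i i′ α β} → DescentArc x i α → DescentArc x i′ β → i < i′ → ¬ Cross α β × ¬ Cross β α
  DescentArc-uncrossed {α = α} {β} da db i<i′ =
    (λ ((_ , both , β<α) , _) → ℕP.<⇒≱ β<α (DescentArc-dominated {α = α} {β} da db i<i′ both)) ,
    (λ (_ , (_ , (lo′≤c , c≤hi′ , lo≤c , c≤hi) , β<α)) → ℕP.<⇒≱ β<α (DescentArc-dominated {α = α} {β} da db i<i′ (lo≤c , c≤hi , lo′≤c , c≤hi′)))

  DescentArc-compatible : ∀ {i i′ α β} → DescentArc x i α → DescentArc x i′ β → i ≢ i′ → Compatible α β
  DescentArc-compatible {i} {i′} {α} {β} da@(j , (adj , _) , lo≡ , hi≡ , _) db@(j′ , (adj′ , _) , lo≡′ , hi≡′ , _) i≢i′ =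
    (λ lo≡lo′ → i≢i′ (adjacent-uniqueˡ adj (subst (Adjacent i′) (px j′ j (sym (trans (sym lo≡) (trans lo≡lo′ lo≡′)))) adj′))) ,
    (λ hi≡hi′ → i≢i′ (px i i′ (trans (sym hi≡) (trans hi≡hi′ hi≡′)))) ,
    uncrossed (FP.<-cmp i i′)
    where
    uncrossed : Tri (i < i′) (i ≡ i′) (i′ < i) → ¬ Cross α β × ¬ Cross β α
    uncrossed (tri< i<i′ _ _) = DescentArc-uncrossed {α = α} {β} da db i<i′
    uncrossed (tri≈ _ i≡i′ _) = contradiction i≡i′ i≢i′
    uncrossed (tri> _ _ i′<i) = let ¬βα , ¬αβ = DescentArc-uncrossed {α = β} {α} db da i′<i in ¬αβ , ¬βα

module _ {n : ℕ} (x : Word n) (px : IsPerm x) where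

  listedUpTo : Fin n → Vec Bool n
  listedUpTo i = tabulate λ c → does (FP.any? λ k → (k F.≤? i) ×-dec (lookup x k F.≟ c))

  -- a descent is recorded at its lower position j, the upper one being F.pred j
  descentArcAt : Fin n → Arc n
  descentArcAt j = arc (lookup x j) (lookup x (F.pred j)) (listedUpTo (F.pred j))

  descentAt? : ∀ j → Dec (Descent x (F.pred j) j)
  descentAt? j = (toℕ j ℕ.≟ suc (toℕ (F.pred j))) ×-dec (lookup x j F.<? lookup x (F.pred j))

  descentDiagram : List (Arc n)
  descentDiagram = L.map descentArcAt (L.filter descentAt? (L.allFin n))

  pred-adjacent : ∀ {i j : Fin n} → Adjacent i j → F.pred j ≡ i
  pred-adjacent {i} {suc j} adj = FP.toℕ-injective (trans (FP.toℕ-inject₁ j) (ℕP.suc-injective adj))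

  lookup-listedUpTo : ∀ i c → lookup (listedUpTo i) c ≡ true ⇔ (Σ (Fin n) λ k → k ≤ i × lookup x k ≡ c)
  lookup-listedUpTo i c rewrite VP.lookup∘tabulate (λ c → does (FP.any? λ k → (k F.≤? i) ×-dec (lookup x k F.≟ c))) c =
    does⇔ (FP.any? λ k → (k F.≤? i) ×-dec (lookup x k F.≟ c))

  descentArcAt-DescentArc : ∀ {j} → Descent x (F.pred j) j → DescentArc x (F.pred j) (descentArcAt j)
  descentArcAt-DescentArc {j} desc = j , desc , refl , refl , λ c _ _ → lookup-listedUpTo (F.pred j) c

  descentDiagram-DescentArcs : DescentArcs x descentDiagram
  descentDiagram-DescentArcs = arcs-descents , descents-arcs
    where
    arcs-descents : ∀ α → α ∈ descentDiagram → Σ (Fin n) λ i → DescentArc x i α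
    arcs-descents α α∈ with ∈P.∈-map⁻ descentArcAt α∈
    ... | j , j∈ , refl = F.pred j , descentArcAt-DescentArc (proj₂ (∈P.∈-filter⁻ descentAt? {xs = L.allFin n} j∈))
    descents-arcs : ∀ i j → Descent x i j → Σ (Arc n) λ α → α ∈ descentDiagram × DescentArc x i α
    descents-arcs i j desc with pred-adjacent (proj₁ desc)
    ... | refl = descentArcAt j , ∈P.∈-map⁺ descentArcAt (∈P.∈-filter⁺ descentAt? (∈P.∈-allFin j) desc) , descentArcAt-DescentArc desc

  descentDiagram-noncrossing : IsNoncrossingDiagram descentDiagram
  descentDiagram-noncrossing =
    AllPairs-noncrossing (λ α α∈ → let i , da = proj₁ descentDiagram-DescentArcs α α∈ in DescentArc-valid x {α = α} da)
      (AllPairs.map⁺ (filter-AllPairs descentAt? compatible (UniqueP.allFin⁺ n)))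
    where
    compatible : ∀ {j j′} → Descent x (F.pred j) j → Descent x (F.pred j′) j′ → j ≢ j′ → Compatible (descentArcAt j) (descentArcAt j′)
    compatible {j} {j′} desc desc′ j≢j′ = DescentArc-compatible x px {α = descentArcAt j} {descentArcAt j′}
      (descentArcAt-DescentArc desc) (descentArcAt-DescentArc desc′)
      (λ i≡i′ → j≢j′ (adjacent-unique (proj₁ desc) (subst (λ i → Adjacent i j′) (sym i≡i′) (proj₁ desc′))))

-- Every noncrossing diagram is the diagram of descent arcs of a permutation

record Noncrossing {n : ℕ} (D : List (Arc n)) : Set where
  field
    valid : ∀ α → α ∈ D → ValidArc α
    lo-injective : ∀ {α β} → α ∈ D → β ∈ D → lo α ≡ lo β → α ≡ β
    hi-injective : ∀ {α β} → α ∈ D → β ∈ D → hi α ≡ hi β → α ≡ β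
    uncrossed : ∀ {α β} → α ∈ D → β ∈ D → ¬ Cross α β

Cross-irrefl : ∀ {n} (α : Arc n) → ¬ Cross α α
Cross-irrefl α ((_ , _ , α<α) , _) = ℕP.<-irrefl refl α<α

IsNoncrossingDiagram⇒Noncrossing : ∀ {n} (D : List (Arc n)) → IsNoncrossingDiagram D → Noncrossing D
IsNoncrossingDiagram⇒Noncrossing D (valid , distinct) = record
  { valid = valid ; lo-injective = lo-injective ; hi-injective = hi-injective ; uncrossed = uncrossed }
  where
  index-of : ∀ {α} → α ∈ D → ∃ λ p → L.lookup D p ≡ α
  index-of α∈ = Any.index α∈ , sym (lookup-index α∈)
  lo-injective : ∀ {α β} → α ∈ D → β ∈ D → lo α ≡ lo β → α ≡ β
  lo-injective α∈ β∈ eq with index-of α∈ | index-of β∈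
  ... | p , refl | q , refl with p F.≟ q
  ...   | yes refl = refl
  ...   | no p≢q = contradiction eq (proj₁ (distinct p q p≢q))
  hi-injective : ∀ {α β} → α ∈ D → β ∈ D → hi α ≡ hi β → α ≡ β
  hi-injective α∈ β∈ eq with index-of α∈ | index-of β∈
  ... | p , refl | q , refl with p F.≟ q
  ...   | yes refl = refl
  ...   | no p≢q = contradiction eq (proj₁ (proj₂ (distinct p q p≢q)))
  uncrossed : ∀ {α β} → α ∈ D → β ∈ D → ¬ Cross α β
  uncrossed α∈ β∈ with index-of α∈ | index-of β∈
  ... | p , refl | q , refl with p F.≟ q
  ...   | yes refl = Cross-irrefl (L.lookup D p)
  ...   | no p≢q = proj₂ (proj₂ (distinct p q p≢q))

-- the letters c that can be listed first by a permutation whose descent arcs are D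
IsSource : ∀ {n} → List (Arc n) → Fin n → Set
IsSource {n} D c =
  ((α : Arc n) → α ∈ D → lo α ≢ c) ×
  ((α : Arc n) → α ∈ D → lo α < c → c < hi α → lookup (left α) c ≡ true) ×
  ((α : Arc n) → α ∈ D → hi α ≡ c → ∀ d → lo α < d → d < c → lookup (left α) d ≡ false)

Blocking : ∀ {n} → List (Arc n) → Fin n → Set
Blocking {n} D c = Σ (Arc n) λ α → α ∈ D × hi α ≡ c × Σ (Fin n) λ d → lo α < d × d < c × lookup (left α) d ≡ true

isSource? : ∀ {n} (D : List (Arc n)) → Decidable (IsSource D)
isSource? D c =
  ∀∈? (λ α → ¬? (lo α F.≟ c)) D ×-dec
  ∀∈? (λ α → (lo α F.<? c) →-dec (c F.<? hi α) →-dec (lookup (left α) c BoolP.≟ true)) D ×-dec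
  ∀∈? (λ α → (hi α F.≟ c) →-dec FP.all? λ d → (lo α F.<? d) →-dec (d F.<? c) →-dec (lookup (left α) d BoolP.≟ false)) D

blocking? : ∀ {n} (D : List (Arc n)) → Decidable (Blocking D)
blocking? D c = ∃∈? (λ α → (hi α F.≟ c) ×-dec FP.any? λ d → (lo α F.<? d) ×-dec (d F.<? c) ×-dec (lookup (left α) d BoolP.≟ true)) D

module Sources {n : ℕ} {D : List (Arc n)} (nc : Noncrossing D) where

  open Noncrossing nc

  module LastLeft (ρ : Arc n) (ρ∈ : ρ ∈ D) {m : Fin n} (lo<m : lo ρ < m) (m<hi : m < hi ρ) (lm : lookup (left ρ) m ≡ true)
                  (last : ∀ d → m < d → ¬ (lo ρ < d × d < hi ρ × lookup (left ρ) d ≡ true))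
                  (passing-ρ : ∀ γ → γ ∈ D → lo γ < hi ρ → hi ρ < hi γ → lookup (left γ) (hi ρ) ≡ true) where

    private
      lo≤hi = ℕP.<⇒≤ (valid ρ ρ∈)

    -- no arc can pass m on the right or start at m: it would cross ρ, or m would not be last
    blocked : ∀ γ → γ ∈ D → lo γ ≤ m → m < hi γ → ¬ posAt γ m ℕ.≤ 1
    blocked γ γ∈ loγ≤m m<hiγ γ≤1 with FP.<-cmp (hi γ) (hi ρ)
    ... | tri≈ _ hi≡ _ with hi-injective γ∈ ρ∈ hi≡
    ...   | refl = contradiction (subst (ℕ._≤ 1) (posAt-left ρ lo<m m<hi lm) γ≤1) λ { (s≤s ()) }
    blocked γ γ∈ loγ≤m m<hiγ γ≤1 | tri< hiγ<hiρ _ _ with lookup (left ρ) (hi γ) in lρ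
    ... | true = last (hi γ) m<hiγ (FP.<-trans lo<m m<hiγ , hiγ<hiρ , lρ)
    ... | false = uncrossed ρ∈ γ∈
          ((m , (ℕP.<⇒≤ lo<m , ℕP.<⇒≤ m<hi , loγ≤m , ℕP.<⇒≤ m<hiγ) , subst (_ ℕ.<_) (sym (posAt-left ρ lo<m m<hi lm)) (s≤s γ≤1)) ,
           (hi γ , (ℕP.<⇒≤ (FP.<-trans lo<m m<hiγ) , ℕP.<⇒≤ hiγ<hiρ , ℕP.<⇒≤ (valid γ γ∈) , ℕP.≤-refl) ,
            subst₂ ℕ._<_ (sym (posAt-right ρ (FP.<-trans lo<m m<hiγ) hiγ<hiρ lρ)) (sym (posAt-hi γ (valid γ γ∈))) (s≤s z≤n)))
    blocked γ γ∈ loγ≤m m<hiγ γ≤1 | tri> _ _ hiρ<hiγ = uncrossed ρ∈ γ∈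
          ((m , (ℕP.<⇒≤ lo<m , ℕP.<⇒≤ m<hi , loγ≤m , ℕP.<⇒≤ m<hiγ) , subst (_ ℕ.<_) (sym (posAt-left ρ lo<m m<hi lm)) (s≤s γ≤1)) ,
           (hi ρ , (lo≤hi , ℕP.≤-refl , ℕP.<⇒≤ loγ<hiρ , ℕP.<⇒≤ hiρ<hiγ) ,
            subst₂ ℕ._<_ (sym (posAt-hi ρ (valid ρ ρ∈))) (sym (posAt-left γ loγ<hiρ hiρ<hiγ (passing-ρ γ γ∈ loγ<hiρ hiρ<hiγ))) (s≤s (s≤s z≤n))))
      where loγ<hiρ = ℕP.≤-<-trans loγ≤m m<hi

    passing-left : ∀ γ → γ ∈ D → lo γ < m → m < hi γ → lookup (left γ) m ≡ true
    passing-left γ γ∈ loγ<m m<hiγ = BoolP.¬-not λ lγ → blocked γ γ∈ (ℕP.<⇒≤ loγ<m) m<hiγ (subst (ℕ._≤ 1) (sym (posAt-right γ loγ<m m<hiγ lγ)) z≤n)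

    source-or-blocking : IsSource D m ⊎ Blocking D m
    source-or-blocking with blocking? D m
    ... | yes blocking = inj₂ blocking
    ... | no ¬blocking = inj₁ ((λ γ γ∈ lo≡m → blocked γ γ∈ (ℕP.≤-reflexive (cong toℕ lo≡m)) (subst (_< hi γ) lo≡m (valid γ γ∈))
                                                       (ℕP.≤-reflexive (trans (cong (posAt γ) (sym lo≡m)) (posAt-lo γ)))) ,
                              passing-left ,
                              λ γ γ∈ hi≡m d lo<d d<m → BoolP.¬-not λ ld → ¬blocking (γ , γ∈ , hi≡m , d , lo<d , d<m , ld))

  -- the last letter m on the left of ρ is a source unless an arc ending at m is blocking;
  -- then continue with that arc, which ends lower
  source-below : ∀ h (ρ : Arc n) → toℕ (hi ρ) ≡ h → ρ ∈ D →
                 (Σ (Fin n) λ c → lo ρ < c × c < hi ρ × lookup (left ρ) c ≡ true) →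
                 (∀ γ → γ ∈ D → lo γ < hi ρ → hi ρ < hi γ → lookup (left γ) (hi ρ) ≡ true) → ∃ (IsSource D)
  source-below = <-rec _ λ h rec ρ hi≡h ρ∈ has-left passing-ρ →
    case greatest (λ c → (lo ρ F.<? c) ×-dec (c F.<? hi ρ) ×-dec (lookup (left ρ) c BoolP.≟ true)) has-left of λ where
      (m , (lo<m , m<hi , lm) , last) → case LastLeft.source-or-blocking ρ ρ∈ lo<m m<hi lm last passing-ρ of λ where
        (inj₁ source) → m , source
        (inj₂ (γ , γ∈ , hiγ≡m , d , lo<d , d<m , ld)) →
          rec (subst (ℕ._< h) (cong toℕ (sym hiγ≡m)) (subst (toℕ m ℕ.<_) hi≡h m<hi)) γ refl γ∈
              (d , lo<d , subst (d <_) (sym hiγ≡m) d<m , ld)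
              (λ γ′ γ′∈ lo<hiγ hiγ<hi → subst (λ c → lookup (left γ′) c ≡ true) (sym hiγ≡m)
                 (LastLeft.passing-left ρ ρ∈ lo<m m<hi lm last passing-ρ γ′ γ′∈ (subst (lo γ′ <_) hiγ≡m lo<hiγ) (subst (_< hi γ′) hiγ≡m hiγ<hi)))

  source : (top : Fin n) → (∀ c → c ≤ top) → ∃ (IsSource D)
  source top maximal with blocking? D top
  ... | yes (γ , γ∈ , hi≡top , d , lo<d , d<top , ld) =
    source-below _ γ refl γ∈ (d , lo<d , subst (d <_) (sym hi≡top) d<top , ld)
                 (λ γ′ _ _ hi<hi′ → contradiction (subst (_< hi γ′) hi≡top hi<hi′) (ℕP.≤⇒≯ (maximal (hi γ′))))
  ... | no ¬blocking = top ,
    (λ γ γ∈ lo≡top → contradiction (subst (_< hi γ) lo≡top (valid γ γ∈)) (ℕP.≤⇒≯ (maximal (hi γ)))) ,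
    (λ γ _ _ top<hi → contradiction top<hi (ℕP.≤⇒≯ (maximal (hi γ)))) ,
    λ γ γ∈ hi≡top d lo<d d<top → BoolP.¬-not λ ld → ¬blocking (γ , γ∈ , hi≡top , d , lo<d , d<top , ld)

-- α is β with the letter p inserted
record Lift {n : ℕ} (p : Fin (suc n)) (β : Arc n) (α : Arc (suc n)) : Set where
  constructor lifted
  field
    lo-lift : punchIn p (lo β) ≡ lo α
    hi-lift : punchIn p (hi β) ≡ hi α
    left-lift : ∀ c → lookup (left β) c ≡ lookup (left α) (punchIn p c)

open Lift public

module _ {n : ℕ} (p : Fin (suc n)) where

  does-punchIn-≟ : ∀ a b → does (punchIn p a F.≟ punchIn p b) ≡ does (a F.≟ b)
  does-punchIn-≟ a b with a F.≟ b
  ... | yes refl = dec-true (punchIn p a F.≟ punchIn p a) refl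
  ... | no a≢b = dec-false (punchIn p a F.≟ punchIn p b) (a≢b ∘ FP.punchIn-injective p a b)

  Lift-posAt : ∀ {β α} → Lift p β α → ∀ c → posAt α (punchIn p c) ≡ posAt β c
  Lift-posAt {β} (lifted refl refl lefts) c rewrite sym (lefts c) | does-punchIn-≟ c (lo β) | does-punchIn-≟ c (hi β) = refl

  Lift-functional : ∀ {β β′ α} → Lift p β α → Lift p β′ α → β ≡ β′
  Lift-functional {arc l h L} {arc l′ h′ L′} (lifted lo≡ hi≡ lefts) (lifted lo≡′ hi≡′ lefts′)
    with FP.punchIn-injective p l l′ (trans lo≡ (sym lo≡′)) | FP.punchIn-injective p h h′ (trans hi≡ (sym hi≡′))
  ... | refl | refl = cong (arc l h) (trans (sym (VP.tabulate∘lookup L))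
                                      (trans (VP.tabulate-cong (λ c → trans (lefts c) (sym (lefts′ c)))) (VP.tabulate∘lookup L′)))

  Lift-valid : ∀ {β α} → Lift p β α → ValidArc α → ValidArc β
  Lift-valid (lifted lo≡ hi≡ _) lo<hi = punchIn-cancel-< p (subst₂ _<_ (sym lo≡) (sym hi≡) lo<hi)

  Lift-Cross : ∀ {β β′ α α′} → Lift p β α → Lift p β′ α′ → Cross β β′ → Cross α α′
  Lift-Cross {β} {β′} {α} {α′} L L′ ((c , both , r) , (c′ , both′ , r′)) =
    (punchIn p c , lift-both both , subst₂ ℕ._<_ (sym (Lift-posAt {β′} {α′} L′ c)) (sym (Lift-posAt {β} {α} L c)) r) ,
    (punchIn p c′ , lift-both both′ , subst₂ ℕ._<_ (sym (Lift-posAt {β} {α} L c′)) (sym (Lift-posAt {β′} {α′} L′ c′)) r′)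
    where
    mono = FP.punchIn-mono-≤ p
    lift-both : ∀ {c} → InBoth β β′ c → InBoth α α′ (punchIn p c)
    lift-both (lo≤c , c≤hi , lo′≤c , c≤hi′) =
      subst (_≤ _) (lo-lift L) (mono _ _ lo≤c) , subst (_ ≤_) (hi-lift L) (mono _ _ c≤hi) ,
      subst (_≤ _) (lo-lift L′) (mono _ _ lo′≤c) , subst (_ ≤_) (hi-lift L′) (mono _ _ c≤hi′)

  shrink : (α : Arc (suc n)) → lo α ≢ p → hi α ≢ p → Arc n
  shrink α lo≢p hi≢p = arc (punchOut (lo≢p ∘ sym)) (punchOut (hi≢p ∘ sym)) (tabulate (lookup (left α) ∘ punchIn p))

  shrink-Lift : ∀ α (lo≢p : lo α ≢ p) (hi≢p : hi α ≢ p) → Lift p (shrink α lo≢p hi≢p) α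
  shrink-Lift α _ _ = lifted (FP.punchIn-punchOut _) (FP.punchIn-punchOut _) (VP.lookup∘tabulate (lookup (left α) ∘ punchIn p))

  -- the diagram without p and the arcs ending at p; no arc may start at p
  remove : (D : List (Arc (suc n))) → (∀ α → α ∈ D → lo α ≢ p) → List (Arc n)
  remove [] _ = []
  remove (α ∷ D) lo≢p with hi α F.≟ p
  ... | yes _ = remove D (λ β → lo≢p β ∘ there)
  ... | no hi≢p = shrink α (lo≢p α (here refl)) hi≢p ∷ remove D (λ β → lo≢p β ∘ there)

  ∈-remove⁻ : ∀ D lo≢p {β} → β ∈ remove D lo≢p → Σ (Arc (suc n)) λ α → α ∈ D × hi α ≢ p × Lift p β α
  ∈-remove⁻ (α ∷ D) lo≢p β∈ with hi α F.≟ p | β∈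
  ... | yes _ | β∈′ = let α′ , α′∈ , rest = ∈-remove⁻ D (λ β → lo≢p β ∘ there) β∈′ in α′ , there α′∈ , rest
  ... | no hi≢p | here refl = α , here refl , hi≢p , shrink-Lift α (lo≢p α (here refl)) hi≢p
  ... | no _ | there β∈′ = let α′ , α′∈ , rest = ∈-remove⁻ D (λ β → lo≢p β ∘ there) β∈′ in α′ , there α′∈ , rest

  ∈-remove⁺ : ∀ D lo≢p {α} → α ∈ D → hi α ≢ p → Σ (Arc n) λ β → β ∈ remove D lo≢p × Lift p β α
  ∈-remove⁺ (α ∷ D) lo≢p (here refl) hi≢p with hi α F.≟ p
  ... | yes hi≡p = contradiction hi≡p hi≢p
  ... | no hi≢p′ = _ , here refl , shrink-Lift α (lo≢p α (here refl)) hi≢p′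
  ∈-remove⁺ (α′ ∷ D) lo≢p (there α∈) hi≢p with hi α′ F.≟ p | ∈-remove⁺ D (λ β → lo≢p β ∘ there) α∈ hi≢p
  ... | yes _ | β , β∈ , L = β , β∈ , L
  ... | no _  | β , β∈ , L = β , there β∈ , L

  Noncrossing-remove : ∀ {D} lo≢p → Noncrossing D → Noncrossing (remove D lo≢p)
  Noncrossing-remove {D} lo≢p nc = record
    { valid = λ β β∈ → let α , α∈ , _ , L = ∈-remove⁻ D lo≢p β∈ in Lift-valid L (valid α α∈)
    ; lo-injective = λ β∈ β′∈ lo≡ → same-lift β∈ β′∈ λ L L′ α∈ α′∈ → lo-injective α∈ α′∈ (trans (sym (lo-lift L)) (trans (cong (punchIn p) lo≡) (lo-lift L′)))
    ; hi-injective = λ β∈ β′∈ hi≡ → same-lift β∈ β′∈ λ L L′ α∈ α′∈ → hi-injective α∈ α′∈ (trans (sym (hi-lift L)) (trans (cong (punchIn p) hi≡) (hi-lift L′)))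
    ; uncrossed = λ β∈ β′∈ cross → let _ , α∈ , _ , L = ∈-remove⁻ D lo≢p β∈ ; _ , α′∈ , _ , L′ = ∈-remove⁻ D lo≢p β′∈
                                   in uncrossed α∈ α′∈ (Lift-Cross L L′ cross)
    }
    where
    open Noncrossing nc
    same-lift : ∀ {β β′} → β ∈ remove D lo≢p → β′ ∈ remove D lo≢p →
             (∀ {α α′} → Lift p β α → Lift p β′ α′ → α ∈ D → α′ ∈ D → α ≡ α′) → β ≡ β′
    same-lift β∈ β′∈ same with ∈-remove⁻ D lo≢p β∈ | ∈-remove⁻ D lo≢p β′∈
    ... | α , α∈ , _ , L | α′ , α′∈ , _ , L′ with same L L′ α∈ α′∈
    ...   | refl = Lift-functional L L′

first-letter-source : ∀ {n} (y : Word n) → IsPerm y → ∀ {E} → DescentArcs y E → ∀ z → toℕ z ≡ 0 → IsSource E (lookup y z)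
first-letter-source y py (arcs-descents , _) z z≡0 = starts-none , left-of-passing , right-of-ending
  where
  starts-none : ∀ α → α ∈ _ → lo α ≢ lookup y z
  starts-none α α∈ lo≡ with arcs-descents α α∈
  ... | _ , j , (adj , _) , lo≡′ , _ = ℕP.0≢1+n (trans (sym z≡0) (trans (cong toℕ (py z j (trans (sym lo≡) lo≡′))) adj))
  left-of-passing : ∀ α → α ∈ _ → lo α < lookup y z → lookup y z < hi α → lookup (left α) (lookup y z) ≡ true
  left-of-passing α α∈ lo<c c<hi with arcs-descents α α∈
  ... | _ , _ , _ , _ , _ , lefts = Equivalence.from (lefts _ lo<c c<hi) (z , subst (ℕ._≤ _) (sym z≡0) z≤n , refl)
  right-of-ending : ∀ α → α ∈ _ → hi α ≡ lookup y z → ∀ d → lo α < d → d < lookup y z → lookup (left α) d ≡ false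
  right-of-ending α α∈ hi≡ d lo<d d<z with arcs-descents α α∈
  ... | i , _ , _ , _ , hi≡′ , lefts = BoolP.¬-not λ ld →
    let k , k≤i , yk≡d = Equivalence.to (lefts d lo<d (subst (d <_) (sym hi≡) d<z)) ld
        i≡z = py i z (trans (sym hi≡′) hi≡)
        k≡z = FP.toℕ-injective (trans (ℕP.n≤0⇒n≡0 (ℕP.≤-trans k≤i (ℕP.≤-reflexive (trans (cong toℕ i≡z) z≡0)))) (sym z≡0))
    in FP.<⇒≢ d<z (trans (sym yk≡d) (cong (lookup y) k≡z))

module Prepend {N : ℕ} {D : List (Arc (suc N))} (nc : Noncrossing D) {p : Fin (suc N)}
               (source : IsSource D p) (smallest : ∀ d → d < p → ¬ IsSource D d)
               (x′ : Word N) (px′ : IsPerm x′) (arcs′ : DescentArcs x′ (remove p D (proj₁ source))) where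

  open Noncrossing nc

  private
    D′ = remove p D (proj₁ source)
    starts-none = proj₁ source
    left-of-passing = proj₁ (proj₂ source)
    right-of-ending = proj₂ (proj₂ source)

  x : Word (suc N)
  x = p ∷ V.map (punchIn p) x′

  lookup-x-suc : ∀ k → lookup x (suc k) ≡ punchIn p (lookup x′ k)
  lookup-x-suc k = VP.lookup-map k (punchIn p) x′

  x-perm : IsPerm x
  x-perm zero zero _ = refl
  x-perm zero (suc k) eq = contradiction (sym (trans eq (lookup-x-suc k))) (FP.punchInᵢ≢i p _)
  x-perm (suc k) zero eq = contradiction (trans (sym (lookup-x-suc k)) eq) (FP.punchInᵢ≢i p _)
  x-perm (suc k) (suc m) eq = cong suc (px′ k m (FP.punchIn-injective p _ _ (trans (sym (lookup-x-suc k)) (trans eq (lookup-x-suc m)))))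

  lift-DescentArc : ∀ {β α} → Lift p β α → α ∈ D → ∀ {i} → DescentArc x′ i β → DescentArc x (suc i) α
  lift-DescentArc {β} {α} L α∈ {i} (j , (adj , xj<xi) , lo≡ , hi≡ , lefts) =
    suc j , (cong suc adj , subst₂ _<_ (sym (lookup-x-suc j)) (sym (lookup-x-suc i)) (punchIn-mono-< p xj<xi)) ,
    trans (sym (lo-lift L)) (trans (cong (punchIn p) lo≡) (sym (lookup-x-suc j))) ,
    trans (sym (hi-lift L)) (trans (cong (punchIn p) hi≡) (sym (lookup-x-suc i))) ,
    lifted-lefts
    where
    lifted-lefts : LeftOfDescent x (suc i) α
    lifted-lefts c lo<c c<hi with c F.≟ p
    ... | yes refl = mk⇔ (λ _ → zero , z≤n , refl) (λ _ → left-of-passing α α∈ lo<c c<hi)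
    ... | no c≢p with punchIn-surjective p c≢p
    ...   | c′ , refl = mk⇔ listed left-lifted
      where
      lo<c′ = punchIn-cancel-< p (subst (_< c) (sym (lo-lift L)) lo<c)
      c′<hi = punchIn-cancel-< p (subst (c <_) (sym (hi-lift L)) c<hi)
      listed : lookup (left α) c ≡ true → Σ (Fin (suc N)) λ k → k ≤ suc i × lookup x k ≡ c
      listed lc with Equivalence.to (lefts c′ lo<c′ c′<hi) (trans (left-lift L c′) lc)
      ... | k , k≤i , refl = suc k , s≤s k≤i , lookup-x-suc k
      left-lifted : (Σ (Fin (suc N)) λ k → k ≤ suc i × lookup x k ≡ c) → lookup (left α) c ≡ true
      left-lifted (zero , _ , p≡c) = contradiction (sym p≡c) c≢p
      left-lifted (suc k , s≤s k≤i , xk≡c) = trans (sym (left-lift L c′))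
        (Equivalence.from (lefts c′ lo<c′ c′<hi) (k , k≤i , FP.punchIn-injective p _ _ (trans (sym (lookup-x-suc k)) xk≡c)))

  lift-source : ∀ {q} → IsSource D′ q → punchIn p q < p → (∀ α → α ∈ D → hi α ≡ p → punchIn p q < lo α) →
                IsSource D (punchIn p q)
  lift-source {q} (starts-none′ , left-of-passing′ , right-of-ending′) q<p below-ending = starts-none″ , left-of-passing″ , right-of-ending″
    where
    starts-none″ : ∀ α → α ∈ D → lo α ≢ punchIn p q
    starts-none″ α α∈ lo≡ with hi α F.≟ p
    ... | yes hi≡p = FP.<⇒≢ (below-ending α α∈ hi≡p) (sym lo≡)
    ... | no hi≢p with ∈-remove⁺ p D starts-none α∈ hi≢p
    ...   | β , β∈ , L = starts-none′ β β∈ (FP.punchIn-injective p _ _ (trans (lo-lift L) lo≡))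
    left-of-passing″ : ∀ α → α ∈ D → lo α < punchIn p q → punchIn p q < hi α → lookup (left α) (punchIn p q) ≡ true
    left-of-passing″ α α∈ lo<q q<hi with hi α F.≟ p
    ... | yes hi≡p = contradiction lo<q (FP.<-asym (below-ending α α∈ hi≡p))
    ... | no hi≢p with ∈-remove⁺ p D starts-none α∈ hi≢p
    ...   | β , β∈ , L = trans (sym (left-lift L q)) (left-of-passing′ β β∈ (punchIn-cancel-< p (subst (_< _) (sym (lo-lift L)) lo<q))
                                                                             (punchIn-cancel-< p (subst (_ <_) (sym (hi-lift L)) q<hi)))
    right-of-ending″ : ∀ α → α ∈ D → hi α ≡ punchIn p q → ∀ d → lo α < d → d < punchIn p q → lookup (left α) d ≡ false
    right-of-ending″ α α∈ hi≡ d lo<d d<q with hi α F.≟ p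
    ... | yes hi≡p = contradiction (trans (sym hi≡) hi≡p) (FP.punchInᵢ≢i p q)
    ... | no hi≢p with ∈-remove⁺ p D starts-none α∈ hi≢p | punchIn-surjective p {d} (FP.<⇒≢ (FP.<-trans d<q q<p))
    ...   | β , β∈ , L | d′ , refl = trans (sym (left-lift L d′))
      (right-of-ending′ β β∈ (FP.punchIn-injective p _ _ (trans (hi-lift L) hi≡)) d′
                        (punchIn-cancel-< p (subst (_< _) (sym (lo-lift L)) lo<d)) (punchIn-cancel-< p d<q))

  -- otherwise the lifted first letter of x′ would be a source smaller than p
  first-letter-not-below : ∀ z → toℕ z ≡ 0 → punchIn p (lookup x′ z) < p →
                           ¬ (∀ α → α ∈ D → hi α ≡ p → punchIn p (lookup x′ z) < lo α)
  first-letter-not-below z z≡0 q<p below-ending =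
    smallest _ q<p (lift-source (first-letter-source x′ px′ arcs′ z z≡0) q<p below-ending)

  module EndingAtP (α₀ : Arc (suc N)) (α₀∈ : α₀ ∈ D) (hi≡p : hi α₀ ≡ p) where

    private
      lo<p : lo α₀ < p
      lo<p = subst (lo α₀ <_) hi≡p (valid α₀ α₀∈)

    at-lo₀ : ∀ {α} → lo α < lo α₀ → lo α₀ < hi α → lookup (left α) (lo α₀) ≡ false →
             Σ (Fin (suc N)) λ c → InBoth α α₀ c × posAt α c ℕ.< posAt α₀ c
    at-lo₀ {α} lo<lo₀ lo₀<hi lα = lo α₀ , (ℕP.<⇒≤ lo<lo₀ , ℕP.<⇒≤ lo₀<hi , ℕP.≤-refl , ℕP.<⇒≤ (valid α₀ α₀∈)) ,
      subst₂ ℕ._<_ (sym (posAt-right α lo<lo₀ lo₀<hi lα)) (sym (posAt-lo α₀)) (s≤s z≤n)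

    -- lo α₀ cannot lie right of an arc passing it: that arc would cross α₀
    around-lo : ∀ {α} → α ∈ D → hi α ≢ p → lo α < lo α₀ → lo α₀ < hi α → ¬ lookup (left α) (lo α₀) ≡ false
    around-lo {α} α∈ hi≢p lo<lo₀ lo₀<hi lα with FP.<-cmp (hi α) p
    ... | tri≈ _ hi≡ _ = hi≢p hi≡
    ... | tri> _ _ p<hi = uncrossed α∈ α₀∈
          ((p , (ℕP.<⇒≤ (FP.<-trans lo<lo₀ lo<p) , ℕP.<⇒≤ p<hi , ℕP.<⇒≤ lo<p , ℕP.≤-reflexive (cong toℕ (sym hi≡p))) ,
            subst₂ ℕ._<_ (sym (trans (cong (posAt α₀) (sym hi≡p)) (posAt-hi α₀ (valid α₀ α₀∈))))
                         (sym (posAt-left α lo<p′ p<hi (left-of-passing α α∈ lo<p′ p<hi))) (s≤s (s≤s z≤n))) ,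
           at-lo₀ {α} lo<lo₀ lo₀<hi lα)
      where lo<p′ = FP.<-trans lo<lo₀ lo<p
    ... | tri< hi<p _ _ = uncrossed α∈ α₀∈
          ((hi α , (ℕP.<⇒≤ (valid α α∈) , ℕP.≤-refl , ℕP.<⇒≤ lo₀<hi , ℕP.<⇒≤ (subst (hi α <_) (sym hi≡p) hi<p)) ,
            subst₂ ℕ._<_ (sym (posAt-right α₀ lo₀<hi (subst (hi α <_) (sym hi≡p) hi<p) (right-of-ending α₀ α₀∈ hi≡p (hi α) lo₀<hi hi<p)))
                         (sym (posAt-hi α (valid α α∈))) (s≤s z≤n)) ,
           at-lo₀ {α} lo<lo₀ lo₀<hi lα)

    a′ : Fin N
    a′ = proj₁ (punchIn-surjective p (starts-none α₀ α₀∈))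

    a′-lo : punchIn p a′ ≡ lo α₀
    a′-lo = proj₂ (punchIn-surjective p (starts-none α₀ α₀∈))

    k = position x′ px′ a′

    -- a letter above a′ before it would give a descent of x′ whose arc lifts to one crossing α₀
    none-above-before : ∀ {t₀} → t₀ < k → ¬ a′ < lookup x′ t₀
    none-above-before {t₀} t₀<k a′<xt₀
      with step-between (λ t → a′ F.<? lookup x′ t) (ℕP.<⇒≤ t₀<k) a′<xt₀ (subst (λ c → ¬ a′ < c) (sym (lookup-position x′ px′ a′)) (FP.<-irrefl refl))
    ... | t , t′ , adj , t₀≤t , t′≤k , a′<xt , a′≮xt′ with proj₂ arcs′ t t′ (adj , ℕP.≤-<-trans (ℕP.≮⇒≥ a′≮xt′) a′<xt)
    ...   | β , β∈ , (j , (adj′ , _) , lo≡ , hi≡ , lefts) with adjacent-unique adj adj′ | ∈-remove⁻ p D starts-none β∈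
    ...     | refl | α , α∈ , hi≢p , L with t′ F.≟ k
    ...       | yes refl = hi≢p (trans (cong hi (lo-injective α∈ α₀∈ (trans (sym (lo-lift L)) (trans (cong (punchIn p) (trans lo≡ (lookup-position x′ px′ a′))) a′-lo)))) hi≡p)
    ...       | no t′≢k = around-lo α∈ hi≢p (subst₂ _<_ (lo-lift L) a′-lo (punchIn-mono-< p lo<a′)) (subst₂ _<_ a′-lo (hi-lift L) (punchIn-mono-< p a′<hi))
                            (trans (cong (lookup (left α)) (sym a′-lo)) (trans (sym (left-lift L a′)) right-of-β))
      where
      lo<a′ : lo β < a′
      lo<a′ = subst (_< a′) (sym lo≡) (FP.≤∧≢⇒< (ℕP.≮⇒≥ a′≮xt′) (t′≢k ∘ sym ∘ position-unique x′ px′))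
      a′<hi : a′ < hi β
      a′<hi = subst (a′ <_) (sym hi≡) a′<xt
      right-of-β : lookup (left β) a′ ≡ false
      right-of-β = BoolP.¬-not λ lβ → let k′ , k′≤t , xk′≡a′ = Equivalence.to (lefts a′ lo<a′ a′<hi) lβ in
        ℕP.<-irrefl refl (ℕP.≤-<-trans (subst (_≤ t) (sym (position-unique x′ px′ xk′≡a′)) k′≤t) (ℕP.<-≤-trans (adjacent⇒< adj) t′≤k))

    k≡0 : toℕ k ≡ 0
    k≡0 with toℕ k ℕ.≟ 0
    ... | yes k≡0 = k≡0
    ... | no k≢0 = ⊥-elim (first-letter-not-below z₀ (FP.toℕ-fromℕ< _) (FP.<-trans x′z₀<lo lo<p) below-ending)
      where
      z₀ : Fin N
      z₀ = fromℕ< (ℕP.<-trans (ℕP.n≢0⇒n>0 k≢0) (FP.toℕ<n k))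
      z₀<k : z₀ < k
      z₀<k = subst (ℕ._< toℕ k) (sym (FP.toℕ-fromℕ< _)) (ℕP.n≢0⇒n>0 k≢0)
      x′z₀<lo : punchIn p (lookup x′ z₀) < lo α₀
      x′z₀<lo = subst (punchIn p (lookup x′ z₀) <_) a′-lo (punchIn-mono-< p (FP.≤∧≢⇒< (ℕP.≮⇒≥ (none-above-before z₀<k))
                  (λ eq → FP.<⇒≢ z₀<k (sym (position-unique x′ px′ eq)))))
      below-ending : ∀ α → α ∈ D → hi α ≡ p → punchIn p (lookup x′ z₀) < lo α
      below-ending α α∈ hiα≡p with hi-injective α∈ α₀∈ (trans hiα≡p (sym hi≡p))
      ... | refl = x′z₀<lo

    DescentArc-first : DescentArc x zero α₀
    DescentArc-first = suc k , (cong suc k≡0 , subst (_< p) (sym x₁≡lo) lo<p) , sym x₁≡lo , hi≡p ,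
      λ c lo<c c<hi → mk⇔ (λ lc → contradiction (trans (sym lc) (right-of-ending α₀ α₀∈ hi≡p c lo<c (subst (c <_) hi≡p c<hi))) λ ())
                          λ { (zero , _ , p≡c) → contradiction (trans hi≡p p≡c) (FP.<⇒≢ c<hi ∘ sym) }
      where
      x₁≡lo : lookup x (suc k) ≡ lo α₀
      x₁≡lo = trans (lookup-x-suc k) (trans (cong (punchIn p) (lookup-position x′ px′ a′)) a′-lo)

  x-DescentArcs : DescentArcs x D
  x-DescentArcs = arcs-descents , descents-arcs
    where
    arcs-descents : ∀ α → α ∈ D → Σ (Fin (suc N)) λ i → DescentArc x i α
    arcs-descents α α∈ with hi α F.≟ p
    ... | yes hi≡p = zero , EndingAtP.DescentArc-first α α∈ hi≡p
    ... | no hi≢p with ∈-remove⁺ p D starts-none α∈ hi≢p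
    ...   | β , β∈ , L = let i , db = proj₁ arcs′ β β∈ in suc i , lift-DescentArc L α∈ db
    descents-arcs : ∀ i j → Descent x i j → Σ (Arc (suc N)) λ α → α ∈ D × DescentArc x i α
    descents-arcs zero zero (() , _)
    descents-arcs (suc i) zero (() , _)
    descents-arcs zero (suc k) (adj , x₁<p) with ∃∈? (λ α → hi α F.≟ p) D
    ... | yes (α₀ , α₀∈ , hi≡p) = α₀ , α₀∈ , EndingAtP.DescentArc-first α₀ α₀∈ hi≡p
    ... | no none = ⊥-elim (first-letter-not-below k (ℕP.suc-injective adj) (subst (_< p) (lookup-x-suc k) x₁<p)
                                                    λ α α∈ hi≡p → contradiction (α , α∈ , hi≡p) none)
    descents-arcs (suc i) (suc j) (adj , xj<xi)
      with proj₂ arcs′ i j (ℕP.suc-injective adj , punchIn-cancel-< p (subst₂ _<_ (lookup-x-suc j) (lookup-x-suc i) xj<xi))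
    ... | β , β∈ , db with ∈-remove⁻ p D starts-none β∈
    ...   | α , α∈ , _ , L = α , α∈ , lift-DescentArc L α∈ db

realize : ∀ n (D : List (Arc n)) → Noncrossing D → Σ (Word n) λ x → IsPerm x × DescentArcs x D
realize zero D nc = [] , (λ ()) , (λ α _ → case lo α of λ ()) , λ ()
realize (suc n) D nc with least (isSource? D) (Sources.source nc (F.fromℕ n) FP.≤fromℕ)
... | p , source , smallest with realize n (remove p D (proj₁ source)) (Noncrossing-remove p (proj₁ source) nc)
...   | x′ , px′ , arcs′ = x , x-perm , x-DescentArcs
  where open Prepend nc source smallest x′ px′ arcs′

theorem3p1 : (n : ℕ) →
  ((x : Vec (Fin n) n) → IsPerm x →
     Σ (Diagram n) λ D → IsNoncrossingDiagram D × Delta x D ×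
       ((D′ : Diagram n) → Delta x D′ → D′ ≈D D)) ×
  ((D : Diagram n) → IsNoncrossingDiagram D →
     Σ (Vec (Fin n) n) λ x → IsPerm x × Delta x D) ×
  ((x y : Vec (Fin n) n) (D E : Diagram n) → IsPerm x → IsPerm y →
     Delta x D → Delta y E → D ≈D E → x ≡ y)
theorem3p1 n = well-defined , surjective , Delta-injective
  where
  well-defined : (x : Word n) → IsPerm x → Σ (Diagram n) λ D → IsNoncrossingDiagram D × Delta x D × ((D′ : Diagram n) → Delta x D′ → D′ ≈D D)
  well-defined x px = descentDiagram x px , descentDiagram-noncrossing x px , δx , λ D′ δ′ → Delta-unique x _ D′ δx δ′
    where δx = CanonicalJoin.delta x px (descentDiagram x px) (descentDiagram-DescentArcs x px)
  surjective : (D : Diagram n) → IsNoncrossingDiagram D → Σ (Word n) λ x → IsPerm x × Delta x D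
  surjective D nc with realize n D (IsNoncrossingDiagram⇒Noncrossing D nc)
  ... | x , px , arcs = x , px , CanonicalJoin.delta x px D arcs
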